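{- Let $k\ge 3$ and let $C_{2k}=v_1v_2\cdots v_{2k}v_1$ be a cycle. Let $i,j$ be integers with $4<i<j\le 2k$, and let $n_i,n_j\ge 0$ be integers. Let $G$ be the $n$-vertex graph, $n=2k+n_i+n_j$, obtained from $C_{2k}$ by attaching $n_i$ new pendant vertices to $v_i$ and $n_j$ new pendant vertices to $v_j$ (equivalently, identifying $v_i$, resp. $v_j$, with the center of a star $S_{n_i+1}$, resp. $S_{n_j+1}$). Let $G'=G-v_1v_2+v_1v_4$. Then $$\operatorname{per} L(G) > \operatorname{per} L(G').$$
   Context: For a simple graph $H$, $L(H)=D(H)-A(H)$ is its Laplacian matrix ($A(H)$ the adjacency matrix, $D(H)$ the diagonal degree matrix). The permanent of an $n\times n$ matrix $X=(x_{ij})$ is $\operatorname{per} X=\sum_{\sigma\in S_n}\prod_{t=1}^n x_{t\sigma(t)}$. $G-v_1v_2+v_1v_4$ denotes deleting the edge $v_1v_2$ and adding the edge $v_1v_4$. -}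

module Defs where

open import Data.Bool using (Bool; true; false; _∧_; _∨_; not; if_then_else_)
open import Data.Nat using (ℕ; zero; suc; _+_; _*_; _∸_; _%_)
import Data.Nat as ℕ
open import Data.Fin using (Fin; toℕ)
open import Data.List using (List; []; _∷_; concatMap; map; foldr; zipWith; length; filter)
open import Data.List using (allFin)
open import Data.Integer using (ℤ; +_; -_; 1ℤ; 0ℤ)
import Data.Integer as ℤ
open import Relation.Nullary.Decidable using (⌊_⌋)

-- Simple graphs on vertex set Fin n, given by a Bool-valued adjacency
-- relation (the graphs below are built symmetric and loopless).

Graph : ℕ → Set
Graph n = Fin n → Fin n → Bool

deg : ∀ {n} → Graph n → Fin n → ℕ
deg {n} G a = length (filter (λ b → Data.Bool.T? (G a b)) (allFin n))
  where import Data.Bool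

Matrix : ℕ → Set
Matrix n = Fin n → Fin n → ℤ

laplacian : ∀ {n} → Graph n → Matrix n
laplacian G a b =
  (if ⌊ a Data.Fin.≟ b ⌋ then + deg G a else 0ℤ)
  ℤ.- (if G a b then 1ℤ else 0ℤ)
  where import Data.Fin

-- The symmetric group S_n, as the list of all orderings of allFin n.
-- A permutation σ is represented by the list [σ(0), …, σ(n-1)].

insertions : {A : Set} → A → List A → List (List A)
insertions x [] = (x ∷ []) ∷ []
insertions x (y ∷ ys) = (x ∷ y ∷ ys) ∷ map (y ∷_) (insertions x ys)

permutations : {A : Set} → List A → List (List A)
permutations [] = [] ∷ []
permutations (x ∷ xs) = concatMap (insertions x) (permutations xs)

sumℤ : List ℤ → ℤ
sumℤ = foldr ℤ._+_ 0ℤ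

prodℤ : List ℤ → ℤ
prodℤ = foldr ℤ._*_ 1ℤ

per : ∀ {n} → Matrix n → ℤ
per {n} X = sumℤ (map (λ σ → prodℤ (zipWith X (allFin n) σ)) (permutations (allFin n)))

-- Vertices are numbered (via toℕ):
--   0 … 2k-1           : cycle vertices v_1 … v_{2k}   (v_m ↦ m-1)
--   2k … 2k+ni-1       : the ni pendant vertices attached to v_i
--   2k+ni … 2k+ni+nj-1 : the nj pendant vertices attached to v_j

infix 4 _==_
_==_ : ℕ → ℕ → Bool
a == b = ⌊ a ℕ.≟ b ⌋

infix 4 _<ᵇ_
_<ᵇ_ : ℕ → ℕ → Bool
a <ᵇ b = ⌊ a ℕ.<? b ⌋

cycArc : (k : ℕ) → ℕ → ℕ → Bool
cycArc k a b = (a <ᵇ 2 * k) ∧ (b <ᵇ 2 * k) ∧ (b == (suc a % suc (2 * k ∸ 1)))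

pendArc : (k i j ni nj : ℕ) → ℕ → ℕ → Bool
pendArc k i j ni nj a b =
     ((not (a <ᵇ 2 * k)) ∧ (a <ᵇ 2 * k + ni) ∧ (b == i ∸ 1))
  ∨  ((not (a <ᵇ 2 * k + ni)) ∧ (a <ᵇ 2 * k + ni + nj) ∧ (b == j ∸ 1))

adjℕ : (k i j ni nj : ℕ) → ℕ → ℕ → Bool
adjℕ k i j ni nj a b =
  cycArc k a b ∨ cycArc k b a ∨ pendArc k i j ni nj a b ∨ pendArc k i j ni nj b a

graphG : (k i j ni nj : ℕ) → Graph (2 * k + ni + nj)
graphG k i j ni nj a b = adjℕ k i j ni nj (toℕ a) (toℕ b)

sameEdge : ℕ → ℕ → ℕ → ℕ → Bool
sameEdge x y a b = ((a == x) ∧ (b == y)) ∨ ((a == y) ∧ (b == x))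

graphG' : (k i j ni nj : ℕ) → Graph (2 * k + ni + nj)
graphG' k i j ni nj a b =
  (graphG k i j ni nj a b ∧ not (sameEdge 0 1 (toℕ a) (toℕ b)))
  ∨ sameEdge 0 3 (toℕ a) (toℕ b)

module Submission where

-- Write L = L(G) and L′ = L(G′); they agree outside the rows and columns of v₁, v₂, v₄. In G the
-- vertices v₁, …, v₄ form a path meeting the rest only in v₂ₖ and v₅, so expanding both permanents
-- along them leaves six minors of L on the remaining vertices: A (delete v₁, …, v₄), A₄ (also delete
-- v₅, the vertex numbered 4), Aᵧ (also delete v₂ₖ, numbered Y), A₄ᵧ (also delete both) and the two
-- mixed minors Z, Zᵀ, giving
--   per L(G)  = 29A + 12A₄ + 12Aᵧ + 5A₄ᵧ −  Z −  Zᵀ,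
--   per L(G′) = 23A +  6A₄ + 10Aᵧ + 3A₄ᵧ − 3Z − 3Zᵀ.
-- As C₂ₖ is even, G is bipartite, so the signs of the entries of L follow a 2-colouring; hence every
-- principal minor is ≥ 0 and dominates its diagonal product, which makes A ≥ 1. The mixed minor Zᵀ
-- expands along the path v₅ … v₂ₖ, one factor −1 per edge, to (−1)^(2k−5) = −1, and Z = Zᵀ by
-- symmetry. So per L(G) − per L(G′) = 6A + 6A₄ + 2Aᵧ + 2A₄ᵧ − 4 ≥ 2.

module Permanent where

  open import Data.Nat using (suc)
  import Data.Nat.Properties as ℕ
  open import Data.Product using (_×_; _,_; map₂)
  open import Data.List using (List; []; _∷_; map; zipWith; length; _++_; concatMap)
  open import Data.List.Relation.Unary.All using (All; []; _∷_)
  import Data.List.Relation.Unary.All as All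
  open import Data.List.Relation.Unary.All.Properties using (map⁺; concat⁺)
  open import Data.List.Relation.Unary.Any using (Any; here; there)
  open import Data.List.Relation.Unary.AllPairs using (AllPairs; []; _∷_)
  open import Data.Integer using (ℤ; 0ℤ; 1ℤ; _+_; _*_)
  open import Data.Integer.Properties using (+-assoc; +-identityˡ; +-identityʳ; *-zeroˡ; *-zeroʳ; *-distribˡ-+)
  open import Data.Integer.Tactic.RingSolver using (solve-∀)
  open import Data.Unit using (⊤; tt)
  open import Function using (_∘_; flip)
  open import Relation.Binary.PropositionalEquality using (_≡_; _≢_; refl; sym; trans; cong; cong₂; module ≡-Reasoning)
  open import Defs using (insertions; permutations; sumℤ; prodℤ)
  open ≡-Reasoning

  ∑ : {B : Set} → (B → ℤ) → List B → ℤ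
  ∑ f xs = sumℤ (map f xs)

  ∏ : {B : Set} → (B → ℤ) → List B → ℤ
  ∏ f xs = prodℤ (map f xs)

  private variable B C : Set

  ∑-++ : (f : B → ℤ) (xs ys : List B) → ∑ f (xs ++ ys) ≡ ∑ f xs + ∑ f ys
  ∑-++ f []       ys = sym (+-identityˡ (∑ f ys))
  ∑-++ f (x ∷ xs) ys = trans (cong (f x +_) (∑-++ f xs ys)) (sym (+-assoc (f x) (∑ f xs) (∑ f ys)))

  ∑-map : (f : C → ℤ) (g : B → C) (xs : List B) → ∑ f (map g xs) ≡ ∑ (f ∘ g) xs
  ∑-map f g []       = refl
  ∑-map f g (x ∷ xs) = cong (f (g x) +_) (∑-map f g xs)

  ∑-concatMap : (f : C → ℤ) (g : B → List C) (xs : List B) →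
                ∑ f (concatMap g xs) ≡ ∑ (λ x → ∑ f (g x)) xs
  ∑-concatMap f g []       = refl
  ∑-concatMap f g (x ∷ xs) = trans (∑-++ f (g x) (concatMap g xs)) (cong (∑ f (g x) +_) (∑-concatMap f g xs))

  ∑-cong : {f g : B → ℤ} (xs : List B) → (∀ x → f x ≡ g x) → ∑ f xs ≡ ∑ g xs
  ∑-cong []       eq = refl
  ∑-cong (x ∷ xs) eq = cong₂ _+_ (eq x) (∑-cong xs eq)

  ∑-cong-on : {P : B → Set} {f g : B → ℤ} (xs : List B) → All P xs →
              (∀ x → P x → f x ≡ g x) → ∑ f xs ≡ ∑ g xs
  ∑-cong-on []       []         eq = refl
  ∑-cong-on (x ∷ xs) (px ∷ pxs) eq = cong₂ _+_ (eq x px) (∑-cong-on xs pxs eq)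

  ∑-zero-on : {P : B → Set} (f : B → ℤ) (xs : List B) → All P xs →
              (∀ x → P x → f x ≡ 0ℤ) → ∑ f xs ≡ 0ℤ
  ∑-zero-on f []       []         eq = refl
  ∑-zero-on f (x ∷ xs) (px ∷ pxs) eq = cong₂ _+_ (eq x px) (∑-zero-on f xs pxs eq)

  ∑-zero : (f : B → ℤ) (xs : List B) → (∀ x → f x ≡ 0ℤ) → ∑ f xs ≡ 0ℤ
  ∑-zero f []       eq = refl
  ∑-zero f (x ∷ xs) eq = cong₂ _+_ (eq x) (∑-zero f xs eq)

  ∑-+ : (f g : B → ℤ) (xs : List B) → ∑ (λ x → f x + g x) xs ≡ ∑ f xs + ∑ g xs
  ∑-+ f g []       = refl
  ∑-+ f g (x ∷ xs) = trans (cong (f x + g x +_) (∑-+ f g xs)) (interchange (f x) (g x) (∑ f xs) (∑ g xs))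
    where
      interchange : ∀ a b c d → a + b + (c + d) ≡ a + c + (b + d)
      interchange = solve-∀

  ∑-*ˡ : (c : ℤ) (f : B → ℤ) (xs : List B) → ∑ (λ x → c * f x) xs ≡ c * ∑ f xs
  ∑-*ˡ c f []       = sym (*-zeroʳ c)
  ∑-*ˡ c f (x ∷ xs) = trans (cong (c * f x +_) (∑-*ˡ c f xs)) (sym (*-distribˡ-+ c (f x) (∑ f xs)))

  ∑-swap : (F : B → C → ℤ) (xs : List B) (ys : List C) →
           ∑ (λ x → ∑ (F x) ys) xs ≡ ∑ (λ y → ∑ (λ x → F x y) xs) ys
  ∑-swap F []       ys = sym (∑-zero _ ys (λ _ → refl))
  ∑-swap F (x ∷ xs) ys = trans (cong (∑ (F x) ys +_) (∑-swap F xs ys)) (sym (∑-+ (F x) _ ys))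

  module _ {A : Set} where

    deletions : List A → List (A × List A)
    deletions []       = []
    deletions (x ∷ xs) = (x , xs) ∷ map (map₂ (x ∷_)) (deletions xs)

    deletions-length : (xs : List A) → All (λ (_ , ys) → suc (length ys) ≡ length xs) (deletions xs)
    deletions-length []       = []
    deletions-length (x ∷ xs) = refl ∷ map⁺ (All.map (cong suc) (deletions-length xs))

    deletions-removed : {P : A → Set} {xs : List A} → All P xs → All (λ (y , _) → P y) (deletions xs)
    deletions-removed []         = []
    deletions-removed (px ∷ pxs) = px ∷ map⁺ (deletions-removed pxs)

    deletions-remaining : {P : A → Set} {xs : List A} → All P xs → All (λ (_ , ys) → All P ys) (deletions xs)
    deletions-remaining []         = []
    deletions-remaining (px ∷ pxs) = pxs ∷ map⁺ (All.map (px ∷_) (deletions-remaining pxs))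

    deletions-fresh : {xs : List A} → AllPairs _≢_ xs → All (λ (y , ys) → All (_≢ y) ys) (deletions xs)
    deletions-fresh {[]}     []          = []
    deletions-fresh {x ∷ xs} (x∉xs ∷ xs!) =
      All.map (λ x≢y y≡x → x≢y (sym y≡x)) x∉xs ∷
      map⁺ (All.zipWith (λ (fresh , x≢y) → x≢y ∷ fresh) (deletions-fresh xs! , deletions-removed x∉xs))

    ∑-deletions-one : (f : A × List A → ℤ) (pre : List A) (c : A) (post : List A) →
      All (λ x → ∀ ys → f (x , ys) ≡ 0ℤ) pre → All (λ x → ∀ ys → f (x , ys) ≡ 0ℤ) post →
      ∑ f (deletions (pre ++ c ∷ post)) ≡ f (c , pre ++ post)
    ∑-deletions-one f [] c post [] fpost = begin
        f (c , post) + ∑ f (map (map₂ (c ∷_)) (deletions post))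
          ≡⟨ cong (f (c , post) +_) (∑-map f (map₂ (c ∷_)) (deletions post)) ⟩
        f (c , post) + ∑ (f ∘ map₂ (c ∷_)) (deletions post)
          ≡⟨ cong (f (c , post) +_) (∑-zero-on _ _ (deletions-removed fpost) (λ (_ , ys) fx → fx (c ∷ ys))) ⟩
        f (c , post) + 0ℤ
          ≡⟨ +-identityʳ _ ⟩
        f (c , post) ∎
    ∑-deletions-one f (y ∷ pre) c post (fy ∷ fpre) fpost = begin
        f (y , pre ++ c ∷ post) + ∑ f (map (map₂ (y ∷_)) (deletions (pre ++ c ∷ post)))
          ≡⟨ cong₂ _+_ (fy _) (∑-map f (map₂ (y ∷_)) (deletions (pre ++ c ∷ post))) ⟩
        0ℤ + ∑ (f ∘ map₂ (y ∷_)) (deletions (pre ++ c ∷ post))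
          ≡⟨ +-identityˡ _ ⟩
        ∑ (f ∘ map₂ (y ∷_)) (deletions (pre ++ c ∷ post))
          ≡⟨ ∑-deletions-one (f ∘ map₂ (y ∷_)) pre c post (shift fpre) (shift fpost) ⟩
        f (c , y ∷ pre ++ post) ∎
      where
        shift : ∀ {l} → All (λ x → ∀ ys → f (x , ys) ≡ 0ℤ) l → All (λ x → ∀ ys → f (x , y ∷ ys) ≡ 0ℤ) l
        shift = All.map (λ fx ys → fx (y ∷ ys))

    ∑-deletions-two : (f : A × List A → ℤ) (pre : List A) (c₁ : A) (mid : List A) (c₂ : A) (post : List A) →
      All (λ x → ∀ ys → f (x , ys) ≡ 0ℤ) pre → All (λ x → ∀ ys → f (x , ys) ≡ 0ℤ) mid →
      All (λ x → ∀ ys → f (x , ys) ≡ 0ℤ) post →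
      ∑ f (deletions (pre ++ c₁ ∷ mid ++ c₂ ∷ post)) ≡ f (c₁ , pre ++ mid ++ c₂ ∷ post) + f (c₂ , pre ++ c₁ ∷ mid ++ post)
    ∑-deletions-two f [] c₁ mid c₂ post [] fmid fpost =
      cong (f (c₁ , mid ++ c₂ ∷ post) +_)
        (trans (∑-map f (map₂ (c₁ ∷_)) (deletions (mid ++ c₂ ∷ post)))
               (∑-deletions-one (f ∘ map₂ (c₁ ∷_)) mid c₂ post (shift fmid) (shift fpost)))
      where
        shift : ∀ {l} → All (λ x → ∀ ys → f (x , ys) ≡ 0ℤ) l → All (λ x → ∀ ys → f (x , c₁ ∷ ys) ≡ 0ℤ) l
        shift = All.map (λ fx ys → fx (c₁ ∷ ys))
    ∑-deletions-two f (y ∷ pre) c₁ mid c₂ post (fy ∷ fpre) fmid fpost =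
      trans (cong₂ _+_ (fy _) (∑-map f (map₂ (y ∷_)) (deletions (pre ++ c₁ ∷ mid ++ c₂ ∷ post))))
        (trans (+-identityˡ _)
               (∑-deletions-two (f ∘ map₂ (y ∷_)) pre c₁ mid c₂ post (shift fpre) (shift fmid) (shift fpost)))
      where
        shift : ∀ {l} → All (λ x → ∀ ys → f (x , ys) ≡ 0ℤ) l → All (λ x → ∀ ys → f (x , y ∷ ys) ≡ 0ℤ) l
        shift = All.map (λ fx ys → fx (y ∷ ys))

    perOn : (A → A → ℤ) → List A → List A → ℤ
    perOn M rs []       = 1ℤ
    perOn M rs (c ∷ cs) = ∑ (λ (r , rs′) → M r c * perOn M rs′ cs) (deletions rs)

    insertions-length : (x : A) (ys : List A) → All (λ zs → length zs ≡ suc (length ys)) (insertions x ys)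
    insertions-length x []       = refl ∷ []
    insertions-length x (y ∷ ys) = refl ∷ map⁺ (All.map (cong suc) (insertions-length x ys))

    permutations-length : (xs : List A) → All (λ σ → length σ ≡ length xs) (permutations xs)
    permutations-length []       = refl ∷ []
    permutations-length (x ∷ xs) = concat⁺ (map⁺ (All.map (λ {τ} eq → All.map (λ e → trans e (cong suc eq)) (insertions-length x τ))
                                                         (permutations-length xs)))

    module _ (M : A → A → ℤ) where

      permutationTerm : List A → List A → ℤ
      permutationTerm rs σ = prodℤ (zipWith M rs σ)

      ∑-insertions : (x : A) (τ rs : List A) → length rs ≡ suc (length τ) →
        ∑ (permutationTerm rs) (insertions x τ) ≡ ∑ (λ (r , rs′) → M r x * permutationTerm rs′ τ) (deletions rs)
      ∑-insertions x []      (r ∷ [])     _  = refl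
      ∑-insertions x (y ∷ τ) (r ∷ rs)     eq = cong (M r x * permutationTerm rs (y ∷ τ) +_) (begin
          ∑ (permutationTerm (r ∷ rs)) (map (y ∷_) (insertions x τ))
            ≡⟨ ∑-map (permutationTerm (r ∷ rs)) (y ∷_) (insertions x τ) ⟩
          ∑ (λ σ → M r y * permutationTerm rs σ) (insertions x τ)
            ≡⟨ ∑-*ˡ (M r y) (permutationTerm rs) (insertions x τ) ⟩
          M r y * ∑ (permutationTerm rs) (insertions x τ)
            ≡⟨ cong (M r y *_) (∑-insertions x τ rs (ℕ.suc-injective eq)) ⟩
          M r y * ∑ (λ (r′ , rs′) → M r′ x * permutationTerm rs′ τ) (deletions rs)
            ≡⟨ sym (∑-*ˡ (M r y) _ (deletions rs)) ⟩
          ∑ (λ (r′ , rs′) → M r y * (M r′ x * permutationTerm rs′ τ)) (deletions rs)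
            ≡⟨ ∑-cong (deletions rs) (λ (r′ , rs′) → swap₁₂ (M r y) (M r′ x) (permutationTerm rs′ τ)) ⟩
          ∑ (λ (r′ , rs′) → M r′ x * permutationTerm (r ∷ rs′) (y ∷ τ)) (deletions rs)
            ≡⟨ sym (∑-map _ (map₂ (r ∷_)) (deletions rs)) ⟩
          ∑ (λ (r′ , rs′) → M r′ x * permutationTerm rs′ (y ∷ τ)) (map (map₂ (r ∷_)) (deletions rs)) ∎)
        where
          swap₁₂ : ∀ a b c → a * (b * c) ≡ b * (a * c)
          swap₁₂ = solve-∀

      ∑-permutations : (cs rs : List A) → length rs ≡ length cs →
        ∑ (permutationTerm rs) (permutations cs) ≡ perOn M rs cs
      ∑-permutations []       []       _  = refl
      ∑-permutations (x ∷ xs) rs       eq = begin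
          ∑ (permutationTerm rs) (concatMap (insertions x) (permutations xs))
            ≡⟨ ∑-concatMap (permutationTerm rs) (insertions x) (permutations xs) ⟩
          ∑ (λ τ → ∑ (permutationTerm rs) (insertions x τ)) (permutations xs)
            ≡⟨ ∑-cong-on (permutations xs) (permutations-length xs)
                 (λ τ eqτ → ∑-insertions x τ rs (trans eq (cong suc (sym eqτ)))) ⟩
          ∑ (λ τ → ∑ (λ (r , rs′) → M r x * permutationTerm rs′ τ) (deletions rs)) (permutations xs)
            ≡⟨ ∑-swap _ (permutations xs) (deletions rs) ⟩
          ∑ (λ (r , rs′) → ∑ (λ τ → M r x * permutationTerm rs′ τ) (permutations xs)) (deletions rs)
            ≡⟨ ∑-cong-on (deletions rs) (deletions-length rs) (λ (r , rs′) eqr →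
                 trans (∑-*ˡ (M r x) (permutationTerm rs′) (permutations xs))
                       (cong (M r x *_) (∑-permutations xs rs′ (ℕ.suc-injective (trans eqr eq))))) ⟩
          perOn M rs (x ∷ xs) ∎

    perOn-expandRow : (M : A → A → ℤ) (r : A) (rs cs : List A) → length (r ∷ rs) ≡ length cs →
      perOn M (r ∷ rs) cs ≡ ∑ (λ (c , cs′) → M r c * perOn M rs cs′) (deletions cs)
    perOn-expandRow M r rs (x ∷ xs) eq = cong (M r x * perOn M rs xs +_) (begin
        ∑ (λ (r′ , rs′) → M r′ x * perOn M rs′ xs) (map (map₂ (r ∷_)) (deletions rs))
          ≡⟨ ∑-map _ (map₂ (r ∷_)) (deletions rs) ⟩
        ∑ (λ (r′ , rs′) → M r′ x * perOn M (r ∷ rs′) xs) (deletions rs)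
          ≡⟨ ∑-cong-on (deletions rs) (deletions-length rs) (λ (r′ , rs′) eqr → cong (M r′ x *_)
               (perOn-expandRow M r rs′ xs (trans eqr (ℕ.suc-injective eq)))) ⟩
        ∑ (λ (r′ , rs′) → M r′ x * ∑ (λ (c , cs′) → M r c * perOn M rs′ cs′) (deletions xs)) (deletions rs)
          ≡⟨ ∑-cong (deletions rs) (λ (r′ , rs′) → trans (sym (∑-*ˡ (M r′ x) _ (deletions xs)))
               (∑-cong (deletions xs) (λ (c , cs′) → swap₁₂ (M r′ x) (M r c) (perOn M rs′ cs′)))) ⟩
        ∑ (λ (r′ , rs′) → ∑ (λ (c , cs′) → M r c * (M r′ x * perOn M rs′ cs′)) (deletions xs)) (deletions rs)
          ≡⟨ ∑-swap _ (deletions rs) (deletions xs) ⟩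
        ∑ (λ (c , cs′) → ∑ (λ (r′ , rs′) → M r c * (M r′ x * perOn M rs′ cs′)) (deletions rs)) (deletions xs)
          ≡⟨ ∑-cong (deletions xs) (λ (c , cs′) → ∑-*ˡ (M r c) _ (deletions rs)) ⟩
        ∑ (λ (c , cs′) → M r c * perOn M rs (x ∷ cs′)) (deletions xs)
          ≡⟨ sym (∑-map _ (map₂ (x ∷_)) (deletions xs)) ⟩
        ∑ (λ (c , cs′) → M r c * perOn M rs cs′) (map (map₂ (x ∷_)) (deletions xs)) ∎)
      where
        swap₁₂ : ∀ a b c → a * (b * c) ≡ b * (a * c)
        swap₁₂ = solve-∀

    perOn-transpose : (M : A → A → ℤ) (rs cs : List A) → length rs ≡ length cs →
      perOn M rs cs ≡ perOn (flip M) cs rs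
    perOn-transpose M []       []       _  = refl
    perOn-transpose M rs       (x ∷ xs) eq = sym (trans (perOn-expandRow (flip M) x xs rs (sym eq))
      (∑-cong-on (deletions rs) (deletions-length rs) (λ (r , rs′) eqr → cong (M r x *_)
        (sym (perOn-transpose M rs′ xs (ℕ.suc-injective (trans eqr eq)))))))

    perOn-cong-on : {P : A → Set} (M N : A → A → ℤ) (rs cs : List A) → All P rs → All P cs →
      (∀ a b → P a → P b → M a b ≡ N a b) → perOn M rs cs ≡ perOn N rs cs
    perOn-cong-on M N rs []       prs pcs         eq = refl
    perOn-cong-on M N rs (x ∷ xs) prs (px ∷ pxs) eq =
      ∑-cong-on (deletions rs) (All.zip (deletions-removed prs , deletions-remaining prs))
        (λ (r , rs′) (pr , prs′) → cong₂ _*_ (eq r x pr px) (perOn-cong-on M N rs′ xs prs′ pxs eq))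

    perOn-symmetric : (M : A → A → ℤ) → (∀ a b → M a b ≡ M b a) → (rs cs : List A) →
      length rs ≡ length cs → perOn M rs cs ≡ perOn M cs rs
    perOn-symmetric M sym-M rs cs eq = trans (perOn-transpose M rs cs eq)
      (perOn-cong-on {P = λ _ → ⊤} (flip M) M cs rs (All.universal (λ _ → tt) cs) (All.universal (λ _ → tt) rs)
        (λ a b _ _ → sym-M b a))

    perOn-zeroColumn : (M : A → A → ℤ) (c : A) (rs cs : List A) → Any (c ≡_) cs →
      All (λ r → M r c ≡ 0ℤ) rs → perOn M rs cs ≡ 0ℤ
    perOn-zeroColumn M c rs (x ∷ xs) (here refl) zero-c =
      ∑-zero-on _ (deletions rs) (deletions-removed zero-c) (λ (r , rs′) z → cong (_* perOn M rs′ xs) z)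
    perOn-zeroColumn M c rs (x ∷ xs) (there c∈xs) zero-c =
      ∑-zero-on _ (deletions rs) (deletions-remaining zero-c)
        (λ (r , rs′) z → trans (cong (M r x *_) (perOn-zeroColumn M c rs′ xs c∈xs z)) (*-zeroʳ (M r x)))

    perOn-diagonal : (M : A → A → ℤ) (P : A → Set) → (∀ a b → P a → P b → a ≢ b → M a b ≡ 0ℤ) →
      (xs : List A) → All P xs → AllPairs _≢_ xs → perOn M xs xs ≡ ∏ (λ x → M x x) xs
    perOn-diagonal M P offDiag []       []         []           = refl
    perOn-diagonal M P offDiag (x ∷ xs) (px ∷ pxs) (x∉xs ∷ xs!) = begin
        M x x * perOn M xs xs + ∑ (λ (r , rs′) → M r x * perOn M rs′ xs) (map (map₂ (x ∷_)) (deletions xs))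
          ≡⟨ cong₂ _+_ (cong (M x x *_) (perOn-diagonal M P offDiag xs pxs xs!))
               (trans (∑-map _ (map₂ (x ∷_)) (deletions xs))
                 (∑-zero-on _ (deletions xs) (deletions-removed (All.zip (pxs , x∉xs)))
                   (λ (r , rs′) (pr , x≢r) → trans (cong (_* perOn M (x ∷ rs′) xs) (offDiag r x pr px (λ r≡x → x≢r (sym r≡x))))
                                                   (*-zeroˡ (perOn M (x ∷ rs′) xs))))) ⟩
        M x x * ∏ (λ x → M x x) xs + 0ℤ
          ≡⟨ +-identityʳ _ ⟩
        ∏ (λ x → M x x) (x ∷ xs) ∎

    module _ (M : A → A → ℤ) where

      private
        rowVanishes : (r : A) (rs : List A) → ∀ {l} → All (λ x → M r x ≡ 0ℤ) l →
                      All (λ x → ∀ cs → M r x * perOn M rs cs ≡ 0ℤ) l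
        rowVanishes r rs = All.map (λ z cs → trans (cong (_* perOn M rs cs) z) (*-zeroˡ (perOn M rs cs)))

        columnVanishes : (c : A) (cs : List A) → ∀ {l} → All (λ x → M x c ≡ 0ℤ) l →
                         All (λ x → ∀ rs → M x c * perOn M rs cs ≡ 0ℤ) l
        columnVanishes c cs = All.map (λ z rs → trans (cong (_* perOn M rs cs) z) (*-zeroˡ (perOn M rs cs)))

      perOn-row₁ : (r : A) (rs pre : List A) (c : A) (post : List A) → length (r ∷ rs) ≡ length (pre ++ c ∷ post) →
        All (λ x → M r x ≡ 0ℤ) pre → All (λ x → M r x ≡ 0ℤ) post →
        perOn M (r ∷ rs) (pre ++ c ∷ post) ≡ M r c * perOn M rs (pre ++ post)
      perOn-row₁ r rs pre c post eq zpre zpost =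
        trans (perOn-expandRow M r rs (pre ++ c ∷ post) eq)
          (∑-deletions-one _ pre c post (rowVanishes r rs zpre) (rowVanishes r rs zpost))

      perOn-column₁ : (c : A) (cs pre : List A) (r : A) (post : List A) →
        All (λ x → M x c ≡ 0ℤ) pre → All (λ x → M x c ≡ 0ℤ) post →
        perOn M (pre ++ r ∷ post) (c ∷ cs) ≡ M r c * perOn M (pre ++ post) cs
      perOn-column₁ c cs pre r post zpre zpost =
        ∑-deletions-one _ pre r post (columnVanishes c cs zpre) (columnVanishes c cs zpost)

      perOn-row₂ : (r : A) (rs pre : List A) (c₁ : A) (mid : List A) (c₂ : A) (post : List A) →
        length (r ∷ rs) ≡ length (pre ++ c₁ ∷ mid ++ c₂ ∷ post) →
        All (λ x → M r x ≡ 0ℤ) pre → All (λ x → M r x ≡ 0ℤ) mid → All (λ x → M r x ≡ 0ℤ) post →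
        perOn M (r ∷ rs) (pre ++ c₁ ∷ mid ++ c₂ ∷ post) ≡
          M r c₁ * perOn M rs (pre ++ mid ++ c₂ ∷ post) + M r c₂ * perOn M rs (pre ++ c₁ ∷ mid ++ post)
      perOn-row₂ r rs pre c₁ mid c₂ post eq zpre zmid zpost =
        trans (perOn-expandRow M r rs (pre ++ c₁ ∷ mid ++ c₂ ∷ post) eq)
          (∑-deletions-two _ pre c₁ mid c₂ post (rowVanishes r rs zpre) (rowVanishes r rs zmid) (rowVanishes r rs zpost))

      perOn-column₂ : (c : A) (cs pre : List A) (r₁ : A) (mid : List A) (r₂ : A) (post : List A) →
        All (λ x → M x c ≡ 0ℤ) pre → All (λ x → M x c ≡ 0ℤ) mid → All (λ x → M x c ≡ 0ℤ) post →
        perOn M (pre ++ r₁ ∷ mid ++ r₂ ∷ post) (c ∷ cs) ≡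
          M r₁ c * perOn M (pre ++ mid ++ r₂ ∷ post) cs + M r₂ c * perOn M (pre ++ r₁ ∷ mid ++ post) cs
      perOn-column₂ c cs pre r₁ mid r₂ post zpre zmid zpost =
        ∑-deletions-two _ pre r₁ mid r₂ post (columnVanishes c cs zpre) (columnVanishes c cs zmid) (columnVanishes c cs zpost)

      perOn-row₃ : (r : A) (rs : List A) (c₀ : A) (pre : List A) (c₁ : A) (mid : List A) (c₂ : A) (post : List A) →
        length (r ∷ rs) ≡ length (c₀ ∷ pre ++ c₁ ∷ mid ++ c₂ ∷ post) →
        All (λ x → M r x ≡ 0ℤ) pre → All (λ x → M r x ≡ 0ℤ) mid → All (λ x → M r x ≡ 0ℤ) post →
        perOn M (r ∷ rs) (c₀ ∷ pre ++ c₁ ∷ mid ++ c₂ ∷ post) ≡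
          M r c₀ * perOn M rs (pre ++ c₁ ∷ mid ++ c₂ ∷ post)
          + (M r c₁ * perOn M rs (c₀ ∷ pre ++ mid ++ c₂ ∷ post) + M r c₂ * perOn M rs (c₀ ∷ pre ++ c₁ ∷ mid ++ post))
      perOn-row₃ r rs c₀ pre c₁ mid c₂ post eq zpre zmid zpost =
        trans (perOn-expandRow M r rs (c₀ ∷ pre ++ c₁ ∷ mid ++ c₂ ∷ post) eq)
          (cong (M r c₀ * perOn M rs (pre ++ c₁ ∷ mid ++ c₂ ∷ post) +_)
            (trans (∑-map _ (map₂ (c₀ ∷_)) (deletions (pre ++ c₁ ∷ mid ++ c₂ ∷ post)))
              (∑-deletions-two _ pre c₁ mid c₂ post (shift zpre) (shift zmid) (shift zpost))))
        where
          shift : ∀ {l} → All (λ x → M r x ≡ 0ℤ) l → All (λ x → ∀ cs → M r x * perOn M rs (c₀ ∷ cs) ≡ 0ℤ) l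
          shift = All.map (λ z cs → trans (cong (_* perOn M rs (c₀ ∷ cs)) z) (*-zeroˡ (perOn M rs (c₀ ∷ cs))))

      perOn-pendant : (p c : A) (T : List A) → All (λ x → M p x ≡ 0ℤ) T → All (λ x → M x p ≡ 0ℤ) T →
        perOn M (p ∷ c ∷ T) (p ∷ c ∷ T) ≡ M p p * perOn M (c ∷ T) (c ∷ T) + M p c * (M c p * perOn M T T)
      perOn-pendant p c T zrow zcol =
        trans (perOn-row₂ p (c ∷ T) [] p [] c T refl [] [] zrow)
          (cong (λ z → M p p * perOn M (c ∷ T) (c ∷ T) + M p c * z) (perOn-column₁ p T [] c T [] zcol))

  module _ {A B : Set} (f : A → B) (M : A → A → ℤ) (N : B → B → ℤ) (M≗N∘f : ∀ a b → M a b ≡ N (f a) (f b)) where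

    ∑-deletions-map : (F : B × List B → ℤ) (xs : List A) →
      ∑ F (deletions (map f xs)) ≡ ∑ (λ (x , ys) → F (f x , map f ys)) (deletions xs)
    ∑-deletions-map F []       = refl
    ∑-deletions-map F (x ∷ xs) = cong (F (f x , map f xs) +_)
      (trans (∑-map F (map₂ (f x ∷_)) (deletions (map f xs)))
        (trans (∑-deletions-map (F ∘ map₂ (f x ∷_)) xs)
          (sym (∑-map (λ (y , ys) → F (f y , map f ys)) (map₂ (x ∷_)) (deletions xs)))))

    perOn-map : (rs cs : List A) → perOn M rs cs ≡ perOn N (map f rs) (map f cs)
    perOn-map rs []       = refl
    perOn-map rs (x ∷ xs) = sym (trans (∑-deletions-map (λ (r , rs′) → N r (f x) * perOn N rs′ (map f xs)) rs)
      (∑-cong (deletions rs) (λ (r , rs′) → cong₂ _*_ (sym (M≗N∘f r x)) (sym (perOn-map rs′ xs)))))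

module SignPattern where

  open import Data.Nat using (zero; suc; z≤n)
  import Data.Nat.Properties as ℕ
  open import Data.Bool using (Bool; true; false; _xor_)
  open import Data.Bool.Properties using (xor-same; xor-∧-commutativeRing)
  open import Data.Product using (_,_; map₂)
  open import Data.List using (List; []; _∷_; map; length)
  open import Data.List.Relation.Unary.All using (All; []; _∷_)
  import Data.List.Relation.Unary.All as All
  open import Data.List.Relation.Unary.All.Properties using (map⁺)
  open import Data.Integer using (ℤ; +_; -[1+_]; 0ℤ; _+_; _*_; _≤_; +≤+)
  open import Data.Integer.Properties using (≤-refl; ≤-trans; ≤-reflexive; +-mono-≤; +-identityʳ; *-zeroʳ; *-monoˡ-≤-nonNeg; *-monoˡ-≤-nonPos)
  open import Algebra.Bundles using (CommutativeRing)
  open import Algebra.Properties.CommutativeSemigroup (CommutativeRing.+-commutativeSemigroup xor-∧-commutativeRing) using (interchange; x∙yz≈y∙xz)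
  open import Relation.Binary.PropositionalEquality using (_≡_; refl; sym; trans; cong; subst)
  open Permanent

  HasSign : Bool → ℤ → Set
  HasSign false z = 0ℤ ≤ z
  HasSign true  z = z ≤ 0ℤ

  HasSign-0 : ∀ s → HasSign s 0ℤ
  HasSign-0 false = ≤-refl
  HasSign-0 true  = ≤-refl

  HasSign-* : ∀ {s t x y} → HasSign s x → HasSign t y → HasSign (s xor t) (x * y)
  HasSign-* {false} {false} {+ m}       _         hy = ≤-trans (≤-reflexive (sym (*-zeroʳ (+ m)))) (*-monoˡ-≤-nonNeg (+ m) hy)
  HasSign-* {false} {true}  {+ m}       _         hy = ≤-trans (*-monoˡ-≤-nonNeg (+ m) hy) (≤-reflexive (*-zeroʳ (+ m)))
  HasSign-* {true}  {false} {+ zero}    _         _  = ≤-refl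
  HasSign-* {true}  {true}  {+ zero}    _         _  = ≤-refl
  HasSign-* {true}  {_}     {+ suc m}   (+≤+ ())  _
  HasSign-* {true}  {false} { -[1+ m ]} _         hy = ≤-trans (*-monoˡ-≤-nonPos -[1+ m ] hy) (≤-reflexive (*-zeroʳ -[1+ m ]))
  HasSign-* {true}  {true}  { -[1+ m ]} _         hy = ≤-trans (≤-reflexive (sym (*-zeroʳ -[1+ m ]))) (*-monoˡ-≤-nonPos -[1+ m ] hy)

  HasSign-∑ : ∀ {B : Set} (s : Bool) (f : B → ℤ) (xs : List B) → All (λ x → HasSign s (f x)) xs → HasSign s (∑ f xs)
  HasSign-∑ false f []       []         = ≤-refl
  HasSign-∑ true  f []       []         = ≤-refl
  HasSign-∑ false f (x ∷ xs) (hx ∷ hxs) = +-mono-≤ hx (HasSign-∑ false f xs hxs)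
  HasSign-∑ true  f (x ∷ xs) (hx ∷ hxs) = +-mono-≤ hx (HasSign-∑ true f xs hxs)

  -- e.g. the Laplacian of a bipartite graph, with col a 2-colouring
  module _ {A : Set} (M : A → A → ℤ) (col : A → Bool) (signs : ∀ a b → HasSign (col a xor col b) (M a b)) where

    parity : List A → Bool
    parity []       = false
    parity (x ∷ xs) = col x xor parity xs

    deletions-parity : (xs : List A) → All (λ (y , ys) → parity xs ≡ col y xor parity ys) (deletions xs)
    deletions-parity []       = []
    deletions-parity (x ∷ xs) = refl ∷ map⁺ (All.map (λ {(y , ys)} eq →
      trans (cong (col x xor_) eq) (x∙yz≈y∙xz (col x) (col y) (parity ys))) (deletions-parity xs))

    mutual
      perOn-sign : (rs cs : List A) → length rs ≡ length cs → HasSign (parity rs xor parity cs) (perOn M rs cs)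
      perOn-sign []       []       _  = +≤+ z≤n
      perOn-sign rs       (x ∷ xs) eq = HasSign-∑ _ _ (deletions rs) (expansionTerms-sign rs x xs eq)

      expansionTerms-sign : (rs : List A) (x : A) (xs : List A) → length rs ≡ suc (length xs) →
        All (λ (r , rs′) → HasSign (parity rs xor parity (x ∷ xs)) (M r x * perOn M rs′ xs)) (deletions rs)
      expansionTerms-sign rs x xs eq =
        All.map (λ {(r , rs′)} (parity-rs , length-rs′) →
            subst (λ s → HasSign s (M r x * perOn M rs′ xs))
              (trans (interchange (col r) (col x) (parity rs′) (parity xs)) (cong (_xor parity (x ∷ xs)) (sym parity-rs)))
              (HasSign-* (signs r x) (perOn-sign rs′ xs (ℕ.suc-injective (trans length-rs′ eq)))))
          (All.zip (deletions-parity rs , deletions-length rs))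

    perOn-principal-nonneg : (xs : List A) → 0ℤ ≤ perOn M xs xs
    perOn-principal-nonneg xs = subst (λ s → HasSign s (perOn M xs xs)) (xor-same (parity xs)) (perOn-sign xs xs refl)

    -- the diagonal term is one of the (all nonnegative) terms of a principal permanent
    ∏diagonal≤perOn : (xs : List A) → ∏ (λ x → M x x) xs ≤ perOn M xs xs
    ∏diagonal≤perOn []       = ≤-refl
    ∏diagonal≤perOn (x ∷ xs) with expansionTerms-sign (x ∷ xs) x xs refl
    ... | _ ∷ otherTerms =
      subst (_≤ M x x * perOn M xs xs + ∑ (λ (r , rs′) → M r x * perOn M rs′ xs) (map (map₂ (x ∷_)) (deletions xs)))
        (+-identityʳ (M x x * ∏ (λ x → M x x) xs))
        (+-mono-≤ (*-monoˡ-≤ (M x x) (diagonal-nonneg x) (∏diagonal≤perOn xs))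
                  (HasSign-∑ false _ _ (subst (λ s → All (λ (r , rs′) → HasSign s (M r x * perOn M rs′ xs)) _)
                                              (xor-same (parity (x ∷ xs))) otherTerms)))
      where
        diagonal-nonneg : ∀ a → 0ℤ ≤ M a a
        diagonal-nonneg a = subst (λ s → HasSign s (M a a)) (xor-same (col a)) (signs a a)

        *-monoˡ-≤ : ∀ m {a b} → 0ℤ ≤ m → a ≤ b → m * a ≤ m * b
        *-monoˡ-≤ (+ m) _ = *-monoˡ-≤-nonNeg (+ m)

module LaplacianOnNat where

  open import Data.Nat using (ℕ; zero; suc; _+_; _≤_; _<_; z≤n; s≤s)
  import Data.Nat as ℕ
  open import Data.Nat.Properties using (≤-refl; ≤-trans; <⇒≤; <-irrefl; ≤-<-trans; +-suc; +-identityʳ; m≤m+n; m≤n+m; ≤∧≢⇒<)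
  open import Data.Bool using (Bool; true; false; _∨_; if_then_else_)
  open import Data.Bool.Properties using (T?)
  open import Data.Fin using (Fin; toℕ) renaming (zero to fzero; suc to fsuc)
  import Data.Fin as Fin
  open import Data.Fin.Properties using (toℕ-injective)
  open import Data.Product using (_×_; _,_)
  open import Data.Empty using (⊥-elim)
  open import Data.List using (List; []; _∷_; _++_; map; length; filter; allFin; tabulate; iterate)
  open import Data.List.Properties using (map-tabulate)
  open import Data.List.Relation.Unary.All using (All; []; _∷_)
  import Data.List.Relation.Unary.All as All
  open import Data.List.Relation.Unary.Any using (Any; here; there)
  open import Data.List.Relation.Unary.AllPairs using (AllPairs; []; _∷_)
  open import Data.Integer using (ℤ; +_; 0ℤ; 1ℤ; -1ℤ; _-_)
  open import Data.Integer.Properties using () renaming (+-identityʳ to +ℤ-identityʳ)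
  open import Function using (_∘_)
  open import Relation.Nullary using (¬_; yes; no)
  open import Relation.Nullary.Decidable using (⌊_⌋)
  open import Relation.Binary.PropositionalEquality using (_≡_; _≢_; refl; sym; trans; cong; cong₂; subst)
  open import Defs using (_==_; _<ᵇ_; Matrix; laplacian; per)
  open Permanent

  ==⇒≡ : ∀ {a b} → (a == b) ≡ true → a ≡ b
  ==⇒≡ {a} {b} eq with a ℕ.≟ b
  ... | yes a≡b = a≡b

  ==-refl : ∀ a → (a == a) ≡ true
  ==-refl a with a ℕ.≟ a
  ... | yes _  = refl
  ... | no a≢a = ⊥-elim (a≢a refl)

  ≢⇒==false : ∀ {a b} → a ≢ b → (a == b) ≡ false
  ≢⇒==false {a} {b} a≢b with a ℕ.≟ b
  ... | yes a≡b = ⊥-elim (a≢b a≡b)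
  ... | no _    = refl

  <ᵇ⇒< : ∀ {a b} → (a <ᵇ b) ≡ true → a < b
  <ᵇ⇒< {a} {b} eq with a ℕ.<? b
  ... | yes a<b = a<b

  <⇒<ᵇ : ∀ {a b} → a < b → (a <ᵇ b) ≡ true
  <⇒<ᵇ {a} {b} a<b with a ℕ.<? b
  ... | yes _  = refl
  ... | no a≮b = ⊥-elim (a≮b a<b)

  ≮⇒<ᵇfalse : ∀ {a b} → ¬ (a < b) → (a <ᵇ b) ≡ false
  ≮⇒<ᵇfalse {a} {b} a≮b with a ℕ.<? b
  ... | yes a<b = ⊥-elim (a≮b a<b)
  ... | no _    = refl

  count : (ℕ → Bool) → List ℕ → ℕ
  count p []       = 0
  count p (x ∷ xs) = (if p x then 1 else 0) + count p xs

  count-cong : ∀ {p q} xs → (∀ b → p b ≡ q b) → count p xs ≡ count q xs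
  count-cong []       eq = refl
  count-cong (x ∷ xs) eq = cong₂ (λ b c → (if b then 1 else 0) + c) (eq x) (count-cong xs eq)

  count-none : ∀ p xs → All (λ b → p b ≡ false) xs → count p xs ≡ 0
  count-none p []       []         = refl
  count-none p (x ∷ xs) (px ∷ pxs) rewrite px = count-none p xs pxs

  count-∨ : ∀ p q xs → All (λ b → p b ≡ true → q b ≡ false) xs → count (λ b → p b ∨ q b) xs ≡ count p xs + count q xs
  count-∨ p q []       []           = refl
  count-∨ p q (x ∷ xs) (excl ∷ excls) with p x | q x | excl
  ... | true  | true  | e = ⊥-elim (true≢false (e refl))
    where
      true≢false : true ≢ false
      true≢false ()
  ... | true  | false | _ = cong suc (count-∨ p q xs excls)
  ... | false | true  | _ = trans (cong suc (count-∨ p q xs excls)) (sym (+-suc (count p xs) (count q xs)))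
  ... | false | false | _ = count-∨ p q xs excls

  count-pos : ∀ p xs → Any (λ b → p b ≡ true) xs → 1 ≤ count p xs
  count-pos p (x ∷ xs) (here px) rewrite px = s≤s z≤n
  count-pos p (x ∷ xs) (there any) = ≤-trans (count-pos p xs any) (m≤n+m _ _)

  iterate-bounds : ∀ a m → All (λ b → a ≤ b × b < a + m) (iterate suc a m)
  iterate-bounds a zero    = []
  iterate-bounds a (suc m) = (≤-refl , subst (a <_) (sym (+-suc a m)) (s≤s (m≤m+n a m))) ∷
    All.map (λ {b} (a<b , b<) → <⇒≤ a<b , subst (b <_) (sym (+-suc a m)) b<) (iterate-bounds (suc a) m)

  iterate-increasing : ∀ a m → AllPairs _<_ (iterate suc a m)
  iterate-increasing a zero    = []
  iterate-increasing a (suc m) = All.map (λ (a<b , _) → a<b) (iterate-bounds (suc a) m) ∷ iterate-increasing (suc a) m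

  iterate-any : ∀ {P : ℕ → Set} a m u → a ≤ u → u < a + m → P u → Any P (iterate suc a m)
  iterate-any a zero    u a≤u u< _  = ⊥-elim (<-irrefl refl (≤-<-trans a≤u (subst (u <_) (+-identityʳ a) u<)))
  iterate-any a (suc m) u a≤u u< pu with a ℕ.≟ u
  ... | yes refl = here pu
  ... | no a≢u   = there (iterate-any (suc a) m u (≤∧≢⇒< a≤u a≢u) (subst (u <_) (+-suc a m) u<) pu)

  iterate-++ : ∀ a m m′ → iterate suc a (m + m′) ≡ iterate suc a m ++ iterate suc (a + m) m′
  iterate-++ a zero    m′ rewrite +-identityʳ a = refl
  iterate-++ a (suc m) m′ rewrite iterate-++ (suc a) m m′ | +-suc a m = refl

  count-single : ∀ u a m → a ≤ u → u < a + m → count (_== u) (iterate suc a m) ≡ 1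
  count-single u a zero    a≤u u< = ⊥-elim (<-irrefl refl (≤-<-trans a≤u (subst (u <_) (+-identityʳ a) u<)))
  count-single u a (suc m) a≤u u< with a ℕ.≟ u
  ... | yes refl = cong suc (count-none _ (iterate suc (suc a) m)
                     (All.map (λ (a<b , _) → ≢⇒==false (λ b≡a → <-irrefl (sym b≡a) a<b)) (iterate-bounds (suc a) m)))
  ... | no a≢u   = count-single u (suc a) m (≤∧≢⇒< a≤u a≢u) (subst (u <_) (+-suc a m) u<)

  laplacianℕ : List ℕ → (ℕ → ℕ → Bool) → ℕ → ℕ → ℤ
  laplacianℕ V adj a b = (if a == b then + count (adj a) V else 0ℤ) - (if adj a b then 1ℤ else 0ℤ)

  module _ (V : List ℕ) (adj : ℕ → ℕ → Bool) where

    laplacianℕ-nonadjacent : ∀ {a b} → a ≢ b → adj a b ≡ false → laplacianℕ V adj a b ≡ 0ℤ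
    laplacianℕ-nonadjacent a≢b nonadj rewrite ≢⇒==false a≢b | nonadj = refl

    laplacianℕ-adjacent : ∀ {a b} → a ≢ b → adj a b ≡ true → laplacianℕ V adj a b ≡ -1ℤ
    laplacianℕ-adjacent a≢b isadj rewrite ≢⇒==false a≢b | isadj = refl

    laplacianℕ-diagonal : ∀ {a d} → adj a a ≡ false → count (adj a) V ≡ d → laplacianℕ V adj a a ≡ + d
    laplacianℕ-diagonal {a} {d} noloop deg rewrite ==-refl a | noloop | deg = +ℤ-identityʳ (+ d)

  private
    length-filter≡count : {A : Set} (p : A → ℕ) (f : ℕ → Bool) (xs : List A) →
      length (filter (λ x → T? (f (p x))) xs) ≡ count f (map p xs)
    length-filter≡count p f []       = refl
    length-filter≡count p f (x ∷ xs) with f (p x)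
    ... | true  = cong suc (length-filter≡count p f xs)
    ... | false = length-filter≡count p f xs

    tabulate-shift : ∀ m (g : Fin m → ℕ) a → (∀ b → g b ≡ a + toℕ b) → tabulate g ≡ iterate suc a m
    tabulate-shift zero    g a eq = refl
    tabulate-shift (suc m) g a eq = cong₂ _∷_ (trans (eq fzero) (+-identityʳ a))
      (tabulate-shift m (g ∘ fsuc) (suc a) (λ b → trans (eq (fsuc b)) (+-suc a (toℕ b))))

    toℕ-allFin : ∀ n → map toℕ (allFin n) ≡ iterate suc 0 n
    toℕ-allFin n = trans (map-tabulate (λ b → b) toℕ) (tabulate-shift n toℕ 0 (λ b → refl))

    ≟-toℕ : ∀ {n} (a b : Fin n) → ⌊ a Fin.≟ b ⌋ ≡ (toℕ a == toℕ b)
    ≟-toℕ a b with a Fin.≟ b | toℕ a ℕ.≟ toℕ b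
    ... | yes _    | yes _ = refl
    ... | yes refl | no ne = ⊥-elim (ne refl)
    ... | no ne    | yes e = ⊥-elim (ne (toℕ-injective e))
    ... | no _     | no _  = refl

    laplacian≡laplacianℕ : ∀ n (adj : ℕ → ℕ → Bool) (a b : Fin n) →
      laplacian {n} (λ x y → adj (toℕ x) (toℕ y)) a b ≡ laplacianℕ (iterate suc 0 n) adj (toℕ a) (toℕ b)
    laplacian≡laplacianℕ n adj a b
      rewrite ≟-toℕ a b | length-filter≡count toℕ (adj (toℕ a)) (allFin n) | toℕ-allFin n = refl

  per-laplacian : ∀ n (adj : ℕ → ℕ → Bool) →
    per (laplacian {n} (λ x y → adj (toℕ x) (toℕ y))) ≡
    perOn (laplacianℕ (iterate suc 0 n) adj) (iterate suc 0 n) (iterate suc 0 n)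
  per-laplacian n adj =
    trans (∑-permutations L (allFin n) (allFin n) refl)
      (trans (perOn-map toℕ L (laplacianℕ (iterate suc 0 n) adj) (laplacian≡laplacianℕ n adj) (allFin n) (allFin n))
             (cong (λ V → perOn (laplacianℕ (iterate suc 0 n) adj) V V) (toℕ-allFin n)))
    where
      L : Matrix n
      L = laplacian {n} (λ x y → adj (toℕ x) (toℕ y))

module CornerExpansion where

  open import Data.Nat using (ℕ; suc; z≤n; s≤s)
  import Data.Nat.Properties as ℕ
  open import Data.Fin using (Fin; toℕ; #_)
  open import Data.Product using (_×_; proj₁; proj₂)
  open import Data.List using (List; []; _∷_; length; _++_)
  import Data.List as List
  open import Data.List.Properties using (length-++)
  open import Data.List.Relation.Unary.All using (All; []; _∷_)
  import Data.List.Relation.Unary.All as All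
  open import Data.List.Relation.Unary.All.Properties using (++⁺)
  open import Data.List.Relation.Unary.Any using (here)
  open import Data.Integer using (ℤ; +_; 0ℤ; 1ℤ; -1ℤ; _+_; _*_; -_; _-_; _≤_; _<_; +<+)
  open import Data.Integer.Properties using (+-identityʳ; *-zeroʳ; +-monoʳ-<; +-monoˡ-≤; +-mono-≤; <-≤-trans; *-monoˡ-≤-nonNeg)
  open import Data.Integer.Tactic.RingSolver using (solve-∀; solve)
  open import Relation.Binary.PropositionalEquality using (_≡_; refl; sym; trans; cong; subst)
  open Permanent

  private
    pendantStep : ∀ {X U V mpp mpc mcp : ℤ} (d : ℤ) → mpp ≡ d → mpc ≡ -1ℤ → mcp ≡ -1ℤ →
                  X ≡ mpp * U + mpc * (mcp * V) → X ≡ d * U + V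
    pendantStep {U = U} {V} d refl refl refl eq = trans eq (cong (λ w → d * U + w) (lemma V))
      where
        lemma : ∀ v → -1ℤ * (-1ℤ * v) ≡ v
        lemma = solve-∀

    scaleStep : ∀ {X U m : ℤ} (d : ℤ) → m ≡ d → X ≡ m * U → X ≡ d * U
    scaleStep d refl eq = eq

    negateStep : ∀ {X U m : ℤ} → m ≡ -1ℤ → X ≡ m * U → X ≡ - U
    negateStep {U = U} refl eq = trans eq (lemma U)
      where
        lemma : ∀ u → -1ℤ * u ≡ - u
        lemma = solve-∀

    mixedStep : ∀ {X U V m m′ : ℤ} (d : ℤ) → m ≡ d → m′ ≡ -1ℤ → X ≡ m * U + m′ * V → X ≡ d * U - V
    mixedStep {U = U} {V} d refl refl eq = trans eq (cong (λ w → d * U + w) (lemma V))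
      where
        lemma : ∀ v → -1ℤ * v ≡ - v
        lemma = solve-∀

    doubleStep : ∀ {X U V m m′ : ℤ} → m ≡ -1ℤ → m′ ≡ -1ℤ → X ≡ m * U + m′ * V → X ≡ - U - V
    doubleStep {U = U} {V} refl refl eq = trans eq (lemma U V)
      where
        lemma : ∀ u v → -1ℤ * u + -1ℤ * v ≡ - u - v
        lemma = solve-∀

    tripleStep : ∀ {X U V W m₀ m₁ m₂ : ℤ} → m₀ ≡ + 2 → m₁ ≡ -1ℤ → m₂ ≡ -1ℤ →
                 X ≡ m₀ * U + (m₁ * V + m₂ * W) → X ≡ + 2 * U - V - W
    tripleStep {U = U} {V} {W} refl refl refl eq = trans eq (lemma U V W)
      where
        lemma : ∀ u v w → + 2 * u + (-1ℤ * v + -1ℤ * w) ≡ + 2 * u - v - w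
        lemma = solve-∀

    -- Eliminating the intermediate minors from the expansion steps of Corner.Cycle and Corner.Rewired.
    cycleCombination : (s s₂₃ s₃ t₂ t₃ u₁ u₂ u₃ v₁ v₂ v₃ sᵧ sᵧ₂₃ sᵧ₃ p a a₄ aᵧ a₄ᵧ z zᵀ : ℤ) →
      p ≡ + 2 * s - t₂ - t₃ →
      s ≡ + 2 * s₂₃ + s₃ → s₂₃ ≡ + 2 * s₃ + a → s₃ ≡ + 2 * a + a₄ →
      t₂ ≡ - s₂₃ - u₁ → u₁ ≡ - u₂ → u₂ ≡ - u₃ → u₃ ≡ - z →
      t₃ ≡ - v₁ - sᵧ → v₁ ≡ - v₂ → v₂ ≡ - v₃ → v₃ ≡ - zᵀ →
      sᵧ ≡ + 2 * sᵧ₂₃ + sᵧ₃ → sᵧ₂₃ ≡ + 2 * sᵧ₃ + aᵧ → sᵧ₃ ≡ + 2 * aᵧ + a₄ᵧ →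
      p ≡ + 29 * a + + 12 * a₄ + + 12 * aᵧ + + 5 * a₄ᵧ - z - zᵀ
    cycleCombination _ _ _ _ _ _ _ _ _ _ _ _ _ _ _ a a₄ aᵧ a₄ᵧ z zᵀ
      refl refl refl refl refl refl refl refl refl refl refl refl refl refl refl =
      solve (a List.∷ a₄ List.∷ aᵧ List.∷ a₄ᵧ List.∷ z List.∷ zᵀ List.∷ List.[])

    rewiredCombination : (s s₂₃ s₃ t₂ t₃ x₁ x₂ x₃ x₄ x₅ u₃ y₀ y₁ y₂ y₃ v₃ sᵧ sᵧ₂₃ sᵧ₃ p a a₄ aᵧ a₄ᵧ z zᵀ : ℤ) →
      p ≡ + 2 * s - t₂ - t₃ →
      s ≡ + 1 * s₂₃ + s₃ → s₂₃ ≡ + 2 * s₃ + a → s₃ ≡ + 3 * a + a₄ →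
      t₂ ≡ - x₁ - x₃ → x₁ ≡ + 1 * x₂ + a → x₂ ≡ + 2 * a →
      x₃ ≡ + 1 * x₄ - x₅ → x₄ ≡ + 2 * u₃ → x₅ ≡ - u₃ → u₃ ≡ - z →
      t₃ ≡ - y₁ - sᵧ → y₁ ≡ + 1 * y₂ - y₃ → y₂ ≡ + 2 * v₃ - y₀ → y₀ ≡ 0ℤ → y₃ ≡ - v₃ → v₃ ≡ - zᵀ →
      sᵧ ≡ + 1 * sᵧ₂₃ + sᵧ₃ → sᵧ₂₃ ≡ + 2 * sᵧ₃ + aᵧ → sᵧ₃ ≡ + 3 * aᵧ + a₄ᵧ →
      p ≡ + 23 * a + + 6 * a₄ + + 10 * aᵧ + + 3 * a₄ᵧ - + 3 * z - + 3 * zᵀ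
    rewiredCombination _ _ _ _ _ _ _ _ _ _ _ _ _ _ _ _ _ _ _ _ a a₄ aᵧ a₄ᵧ z zᵀ
      refl refl refl refl refl refl refl refl refl refl refl refl refl refl refl refl refl refl refl refl =
      solve (a List.∷ a₄ List.∷ aᵧ List.∷ a₄ᵧ List.∷ z List.∷ zᵀ List.∷ List.[])

  Detached : (ℕ → ℕ → ℤ) → ℕ → Set
  Detached M x = (i : Fin 4) → M (toℕ i) x ≡ 0ℤ × M x (toℕ i) ≡ 0ℤ

  -- Vertices 0,1,2,3,4 stand for v₁,…,v₅ and Y for v₂ₖ; C lists v₆,…,v₂ₖ₋₁ and D the pendant vertices.
  module Corner (M : ℕ → ℕ → ℤ) (Y : ℕ) (C D : List ℕ) where

    R′ R Rᵧ R′ᵧ : List ℕ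
    R′  = C ++ Y ∷ D
    R   = 4 ∷ R′
    Rᵧ  = 4 ∷ C ++ D
    R′ᵧ = C ++ D

    P : List ℕ → List ℕ → ℤ
    P = perOn M

    A A₄ Aᵧ A₄ᵧ Z Zᵀ : ℤ
    A   = P R R
    A₄  = P R′ R′
    Aᵧ  = P Rᵧ Rᵧ
    A₄ᵧ = P R′ᵧ R′ᵧ
    Z   = P Rᵧ R′
    Zᵀ  = P R′ Rᵧ

    length-R′ : length R′ ≡ suc (length R′ᵧ)
    length-R′ = trans (length-++ C) (trans (ℕ.+-suc (length C) (length D)) (cong suc (sym (length-++ C))))

    module _ (C-detached : All (Detached M) C) (D-detached : All (Detached M) D)
      (M₀₂ : M 0 2 ≡ 0ℤ) (M₂₀ : M 2 0 ≡ 0ℤ) (M₁₃ : M 1 3 ≡ 0ℤ) (M₃₁ : M 3 1 ≡ 0ℤ)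
      (M₀₄ : M 0 4 ≡ 0ℤ) (M₄₀ : M 4 0 ≡ 0ℤ) (M₁₄ : M 1 4 ≡ 0ℤ) (M₄₁ : M 4 1 ≡ 0ℤ) (M₂₄ : M 2 4 ≡ 0ℤ) (M₄₂ : M 4 2 ≡ 0ℤ)
      (M₁ᵧ : M 1 Y ≡ 0ℤ) (Mᵧ₁ : M Y 1 ≡ 0ℤ) (M₂ᵧ : M 2 Y ≡ 0ℤ) (Mᵧ₂ : M Y 2 ≡ 0ℤ) (M₃ᵧ : M 3 Y ≡ 0ℤ) (Mᵧ₃ : M Y 3 ≡ 0ℤ) where

      private
        rowZeros : (i : Fin 4) {xs : List ℕ} → All (Detached M) xs → All (λ x → M (toℕ i) x ≡ 0ℤ) xs
        rowZeros i = All.map (λ d → proj₁ (d i))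

        columnZeros : (i : Fin 4) {xs : List ℕ} → All (Detached M) xs → All (λ x → M x (toℕ i) ≡ 0ℤ) xs
        columnZeros i = All.map (λ d → proj₂ (d i))

        R′ᵧ-detached : All (Detached M) R′ᵧ
        R′ᵧ-detached = ++⁺ C-detached D-detached

        row₁-R′ : All (λ x → M 1 x ≡ 0ℤ) R′
        row₁-R′ = ++⁺ (rowZeros (# 1) C-detached) (M₁ᵧ ∷ rowZeros (# 1) D-detached)
        column₁-R′ : All (λ x → M x 1 ≡ 0ℤ) R′
        column₁-R′ = ++⁺ (columnZeros (# 1) C-detached) (Mᵧ₁ ∷ columnZeros (# 1) D-detached)
        row₂-R′ : All (λ x → M 2 x ≡ 0ℤ) R′
        row₂-R′ = ++⁺ (rowZeros (# 2) C-detached) (M₂ᵧ ∷ rowZeros (# 2) D-detached)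
        column₂-R′ : All (λ x → M x 2 ≡ 0ℤ) R′
        column₂-R′ = ++⁺ (columnZeros (# 2) C-detached) (Mᵧ₂ ∷ columnZeros (# 2) D-detached)
        row₃-R′ : All (λ x → M 3 x ≡ 0ℤ) R′
        row₃-R′ = ++⁺ (rowZeros (# 3) C-detached) (M₃ᵧ ∷ rowZeros (# 3) D-detached)
        column₃-R′ : All (λ x → M x 3 ≡ 0ℤ) R′
        column₃-R′ = ++⁺ (columnZeros (# 3) C-detached) (Mᵧ₃ ∷ columnZeros (# 3) D-detached)

        U₃ : P (3 ∷ Rᵧ) R ≡ M 3 4 * Z
        U₃ = perOn-row₁ M 3 Rᵧ [] 4 R′ (cong suc (sym length-R′)) [] row₃-R′
        V₃ : P R (3 ∷ Rᵧ) ≡ M 4 3 * Zᵀ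
        V₃ = perOn-column₁ M 3 Rᵧ [] 4 R′ [] column₃-R′

      module Cycle
        (M₀₀ : M 0 0 ≡ + 2) (M₀₁ : M 0 1 ≡ -1ℤ) (M₀₃ : M 0 3 ≡ 0ℤ) (M₀ᵧ : M 0 Y ≡ -1ℤ)
        (M₁₀ : M 1 0 ≡ -1ℤ) (M₁₁ : M 1 1 ≡ + 2) (M₁₂ : M 1 2 ≡ -1ℤ)
        (M₂₁ : M 2 1 ≡ -1ℤ) (M₂₂ : M 2 2 ≡ + 2) (M₂₃ : M 2 3 ≡ -1ℤ)
        (M₃₀ : M 3 0 ≡ 0ℤ) (M₃₂ : M 3 2 ≡ -1ℤ) (M₃₃ : M 3 3 ≡ + 2) (M₃₄ : M 3 4 ≡ -1ℤ)
        (M₄₃ : M 4 3 ≡ -1ℤ) (Mᵧ₀ : M Y 0 ≡ -1ℤ) where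

        private
          path₃ : P (3 ∷ R) (3 ∷ R) ≡ + 2 * A + A₄
          path₃ = pendantStep (+ 2) M₃₃ M₃₄ M₄₃ (perOn-pendant M 3 4 R′ row₃-R′ column₃-R′)
          path₂ : P (2 ∷ 3 ∷ R) (2 ∷ 3 ∷ R) ≡ + 2 * P (3 ∷ R) (3 ∷ R) + A
          path₂ = pendantStep (+ 2) M₂₂ M₂₃ M₃₂ (perOn-pendant M 2 3 R (M₂₄ ∷ row₂-R′) (M₄₂ ∷ column₂-R′))
          path₁ : P (1 ∷ 2 ∷ 3 ∷ R) (1 ∷ 2 ∷ 3 ∷ R) ≡ + 2 * P (2 ∷ 3 ∷ R) (2 ∷ 3 ∷ R) + P (3 ∷ R) (3 ∷ R)
          path₁ = pendantStep (+ 2) M₁₁ M₁₂ M₂₁ (perOn-pendant M 1 2 (3 ∷ R) (M₁₃ ∷ M₁₄ ∷ row₁-R′) (M₃₁ ∷ M₄₁ ∷ column₁-R′))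

          pathᵧ₃ : P (3 ∷ Rᵧ) (3 ∷ Rᵧ) ≡ + 2 * Aᵧ + A₄ᵧ
          pathᵧ₃ = pendantStep (+ 2) M₃₃ M₃₄ M₄₃
            (perOn-pendant M 3 4 R′ᵧ (rowZeros (# 3) R′ᵧ-detached) (columnZeros (# 3) R′ᵧ-detached))
          pathᵧ₂ : P (2 ∷ 3 ∷ Rᵧ) (2 ∷ 3 ∷ Rᵧ) ≡ + 2 * P (3 ∷ Rᵧ) (3 ∷ Rᵧ) + Aᵧ
          pathᵧ₂ = pendantStep (+ 2) M₂₂ M₂₃ M₃₂
            (perOn-pendant M 2 3 Rᵧ (M₂₄ ∷ rowZeros (# 2) R′ᵧ-detached) (M₄₂ ∷ columnZeros (# 2) R′ᵧ-detached))
          pathᵧ₁ : P (1 ∷ 2 ∷ 3 ∷ Rᵧ) (1 ∷ 2 ∷ 3 ∷ Rᵧ) ≡ + 2 * P (2 ∷ 3 ∷ Rᵧ) (2 ∷ 3 ∷ Rᵧ) + P (3 ∷ Rᵧ) (3 ∷ Rᵧ)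
          pathᵧ₁ = pendantStep (+ 2) M₁₁ M₁₂ M₂₁
            (perOn-pendant M 1 2 (3 ∷ Rᵧ) (M₁₃ ∷ M₁₄ ∷ rowZeros (# 1) R′ᵧ-detached) (M₃₁ ∷ M₄₁ ∷ columnZeros (# 1) R′ᵧ-detached))

          row₀ : P (0 ∷ 1 ∷ 2 ∷ 3 ∷ R) (0 ∷ 1 ∷ 2 ∷ 3 ∷ R) ≡
            + 2 * P (1 ∷ 2 ∷ 3 ∷ R) (1 ∷ 2 ∷ 3 ∷ R) - P (1 ∷ 2 ∷ 3 ∷ R) (0 ∷ 2 ∷ 3 ∷ R) - P (1 ∷ 2 ∷ 3 ∷ R) (0 ∷ 1 ∷ 2 ∷ 3 ∷ Rᵧ)
          row₀ = tripleStep M₀₀ M₀₁ M₀ᵧ (perOn-row₃ M 0 (1 ∷ 2 ∷ 3 ∷ R) 0 [] 1 (2 ∷ 3 ∷ 4 ∷ C) Y D refl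
                   [] (M₀₂ ∷ M₀₃ ∷ M₀₄ ∷ rowZeros (# 0) C-detached) (rowZeros (# 0) D-detached))

          column₀ : P (1 ∷ 2 ∷ 3 ∷ R) (0 ∷ 2 ∷ 3 ∷ R) ≡ - P (2 ∷ 3 ∷ R) (2 ∷ 3 ∷ R) - P (1 ∷ 2 ∷ 3 ∷ Rᵧ) (2 ∷ 3 ∷ R)
          column₀ = doubleStep M₁₀ Mᵧ₀ (perOn-column₂ M 0 (2 ∷ 3 ∷ R) [] 1 (2 ∷ 3 ∷ 4 ∷ C) Y D
                      [] (M₂₀ ∷ M₃₀ ∷ M₄₀ ∷ columnZeros (# 0) C-detached) (columnZeros (# 0) D-detached))
          column₀ᵧ : P (1 ∷ 2 ∷ 3 ∷ R) (0 ∷ 1 ∷ 2 ∷ 3 ∷ Rᵧ) ≡ - P (2 ∷ 3 ∷ R) (1 ∷ 2 ∷ 3 ∷ Rᵧ) - P (1 ∷ 2 ∷ 3 ∷ Rᵧ) (1 ∷ 2 ∷ 3 ∷ Rᵧ)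
          column₀ᵧ = doubleStep M₁₀ Mᵧ₀ (perOn-column₂ M 0 (1 ∷ 2 ∷ 3 ∷ Rᵧ) [] 1 (2 ∷ 3 ∷ 4 ∷ C) Y D
                       [] (M₂₀ ∷ M₃₀ ∷ M₄₀ ∷ columnZeros (# 0) C-detached) (columnZeros (# 0) D-detached))

          U₁ : P (1 ∷ 2 ∷ 3 ∷ Rᵧ) (2 ∷ 3 ∷ R) ≡ - P (2 ∷ 3 ∷ Rᵧ) (3 ∷ R)
          U₁ = negateStep M₁₂ (perOn-row₁ M 1 (2 ∷ 3 ∷ Rᵧ) [] 2 (3 ∷ R) (cong (λ m → suc (suc (suc m))) (sym length-R′))
                 [] (M₁₃ ∷ M₁₄ ∷ row₁-R′))
          U₂ : P (2 ∷ 3 ∷ Rᵧ) (3 ∷ R) ≡ - P (3 ∷ Rᵧ) R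
          U₂ = negateStep M₂₃ (perOn-row₁ M 2 (3 ∷ Rᵧ) [] 3 R (cong (λ m → suc (suc m)) (sym length-R′)) [] (M₂₄ ∷ row₂-R′))
          V₁ : P (2 ∷ 3 ∷ R) (1 ∷ 2 ∷ 3 ∷ Rᵧ) ≡ - P (3 ∷ R) (2 ∷ 3 ∷ Rᵧ)
          V₁ = negateStep M₂₁ (perOn-column₁ M 1 (2 ∷ 3 ∷ Rᵧ) [] 2 (3 ∷ R) [] (M₃₁ ∷ M₄₁ ∷ column₁-R′))
          V₂ : P (3 ∷ R) (2 ∷ 3 ∷ Rᵧ) ≡ - P R (3 ∷ Rᵧ)
          V₂ = negateStep M₃₂ (perOn-column₁ M 2 (3 ∷ Rᵧ) [] 3 R [] (M₄₂ ∷ column₂-R′))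

        perOn-corner : P (0 ∷ 1 ∷ 2 ∷ 3 ∷ R) (0 ∷ 1 ∷ 2 ∷ 3 ∷ R) ≡ + 29 * A + + 12 * A₄ + + 12 * Aᵧ + + 5 * A₄ᵧ - Z - Zᵀ
        perOn-corner = cycleCombination _ _ _ _ _ _ _ _ _ _ _ _ _ _ _ _ _ _ _ _ _
          row₀ path₁ path₂ path₃ column₀ U₁ U₂ (negateStep M₃₄ U₃) column₀ᵧ V₁ V₂ (negateStep M₄₃ V₃) pathᵧ₁ pathᵧ₂ pathᵧ₃

      module Rewired
        (M₀₀ : M 0 0 ≡ + 2) (M₀₁ : M 0 1 ≡ 0ℤ) (M₀₃ : M 0 3 ≡ -1ℤ) (M₀ᵧ : M 0 Y ≡ -1ℤ)
        (M₁₀ : M 1 0 ≡ 0ℤ) (M₁₁ : M 1 1 ≡ + 1) (M₁₂ : M 1 2 ≡ -1ℤ)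
        (M₂₁ : M 2 1 ≡ -1ℤ) (M₂₂ : M 2 2 ≡ + 2) (M₂₃ : M 2 3 ≡ -1ℤ)
        (M₃₀ : M 3 0 ≡ -1ℤ) (M₃₂ : M 3 2 ≡ -1ℤ) (M₃₃ : M 3 3 ≡ + 3) (M₃₄ : M 3 4 ≡ -1ℤ)
        (M₄₃ : M 4 3 ≡ -1ℤ) (Mᵧ₀ : M Y 0 ≡ -1ℤ) where

        private
          path₃ : P (3 ∷ R) (3 ∷ R) ≡ + 3 * A + A₄
          path₃ = pendantStep (+ 3) M₃₃ M₃₄ M₄₃ (perOn-pendant M 3 4 R′ row₃-R′ column₃-R′)
          path₂ : P (2 ∷ 3 ∷ R) (2 ∷ 3 ∷ R) ≡ + 2 * P (3 ∷ R) (3 ∷ R) + A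
          path₂ = pendantStep (+ 2) M₂₂ M₂₃ M₃₂ (perOn-pendant M 2 3 R (M₂₄ ∷ row₂-R′) (M₄₂ ∷ column₂-R′))
          path₁ : P (1 ∷ 2 ∷ 3 ∷ R) (1 ∷ 2 ∷ 3 ∷ R) ≡ + 1 * P (2 ∷ 3 ∷ R) (2 ∷ 3 ∷ R) + P (3 ∷ R) (3 ∷ R)
          path₁ = pendantStep (+ 1) M₁₁ M₁₂ M₂₁ (perOn-pendant M 1 2 (3 ∷ R) (M₁₃ ∷ M₁₄ ∷ row₁-R′) (M₃₁ ∷ M₄₁ ∷ column₁-R′))

          pathᵧ₃ : P (3 ∷ Rᵧ) (3 ∷ Rᵧ) ≡ + 3 * Aᵧ + A₄ᵧ
          pathᵧ₃ = pendantStep (+ 3) M₃₃ M₃₄ M₄₃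
            (perOn-pendant M 3 4 R′ᵧ (rowZeros (# 3) R′ᵧ-detached) (columnZeros (# 3) R′ᵧ-detached))
          pathᵧ₂ : P (2 ∷ 3 ∷ Rᵧ) (2 ∷ 3 ∷ Rᵧ) ≡ + 2 * P (3 ∷ Rᵧ) (3 ∷ Rᵧ) + Aᵧ
          pathᵧ₂ = pendantStep (+ 2) M₂₂ M₂₃ M₃₂
            (perOn-pendant M 2 3 Rᵧ (M₂₄ ∷ rowZeros (# 2) R′ᵧ-detached) (M₄₂ ∷ columnZeros (# 2) R′ᵧ-detached))
          pathᵧ₁ : P (1 ∷ 2 ∷ 3 ∷ Rᵧ) (1 ∷ 2 ∷ 3 ∷ Rᵧ) ≡ + 1 * P (2 ∷ 3 ∷ Rᵧ) (2 ∷ 3 ∷ Rᵧ) + P (3 ∷ Rᵧ) (3 ∷ Rᵧ)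
          pathᵧ₁ = pendantStep (+ 1) M₁₁ M₁₂ M₂₁
            (perOn-pendant M 1 2 (3 ∷ Rᵧ) (M₁₃ ∷ M₁₄ ∷ rowZeros (# 1) R′ᵧ-detached) (M₃₁ ∷ M₄₁ ∷ columnZeros (# 1) R′ᵧ-detached))

          row₀ : P (0 ∷ 1 ∷ 2 ∷ 3 ∷ R) (0 ∷ 1 ∷ 2 ∷ 3 ∷ R) ≡
            + 2 * P (1 ∷ 2 ∷ 3 ∷ R) (1 ∷ 2 ∷ 3 ∷ R) - P (1 ∷ 2 ∷ 3 ∷ R) (0 ∷ 1 ∷ 2 ∷ R) - P (1 ∷ 2 ∷ 3 ∷ R) (0 ∷ 1 ∷ 2 ∷ 3 ∷ Rᵧ)
          row₀ = tripleStep M₀₀ M₀₃ M₀ᵧ (perOn-row₃ M 0 (1 ∷ 2 ∷ 3 ∷ R) 0 (1 ∷ 2 ∷ []) 3 (4 ∷ C) Y D refl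
                   (M₀₁ ∷ M₀₂ ∷ []) (M₀₄ ∷ rowZeros (# 0) C-detached) (rowZeros (# 0) D-detached))

          column₀ : P (1 ∷ 2 ∷ 3 ∷ R) (0 ∷ 1 ∷ 2 ∷ R) ≡ - P (1 ∷ 2 ∷ R) (1 ∷ 2 ∷ R) - P (1 ∷ 2 ∷ 3 ∷ Rᵧ) (1 ∷ 2 ∷ R)
          column₀ = doubleStep M₃₀ Mᵧ₀ (perOn-column₂ M 0 (1 ∷ 2 ∷ R) (1 ∷ 2 ∷ []) 3 (4 ∷ C) Y D
                      (M₁₀ ∷ M₂₀ ∷ []) (M₄₀ ∷ columnZeros (# 0) C-detached) (columnZeros (# 0) D-detached))
          column₀ᵧ : P (1 ∷ 2 ∷ 3 ∷ R) (0 ∷ 1 ∷ 2 ∷ 3 ∷ Rᵧ) ≡ - P (1 ∷ 2 ∷ R) (1 ∷ 2 ∷ 3 ∷ Rᵧ) - P (1 ∷ 2 ∷ 3 ∷ Rᵧ) (1 ∷ 2 ∷ 3 ∷ Rᵧ)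
          column₀ᵧ = doubleStep M₃₀ Mᵧ₀ (perOn-column₂ M 0 (1 ∷ 2 ∷ 3 ∷ Rᵧ) (1 ∷ 2 ∷ []) 3 (4 ∷ C) Y D
                       (M₁₀ ∷ M₂₀ ∷ []) (M₄₀ ∷ columnZeros (# 0) C-detached) (columnZeros (# 0) D-detached))

          X₁ : P (1 ∷ 2 ∷ R) (1 ∷ 2 ∷ R) ≡ + 1 * P (2 ∷ R) (2 ∷ R) + A
          X₁ = pendantStep (+ 1) M₁₁ M₁₂ M₂₁ (perOn-pendant M 1 2 R (M₁₄ ∷ row₁-R′) (M₄₁ ∷ column₁-R′))
          X₂ : P (2 ∷ R) (2 ∷ R) ≡ + 2 * A
          X₂ = scaleStep (+ 2) M₂₂ (perOn-row₁ M 2 R [] 2 R refl [] (M₂₄ ∷ row₂-R′))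
          X₃ : P (1 ∷ 2 ∷ 3 ∷ Rᵧ) (1 ∷ 2 ∷ R) ≡ + 1 * P (2 ∷ 3 ∷ Rᵧ) (2 ∷ R) - P (2 ∷ 3 ∷ Rᵧ) (1 ∷ R)
          X₃ = mixedStep (+ 1) M₁₁ M₁₂ (perOn-row₂ M 1 (2 ∷ 3 ∷ Rᵧ) [] 1 [] 2 R
                 (cong (λ m → suc (suc (suc m))) (sym length-R′)) [] [] (M₁₄ ∷ row₁-R′))
          X₄ : P (2 ∷ 3 ∷ Rᵧ) (2 ∷ R) ≡ + 2 * P (3 ∷ Rᵧ) R
          X₄ = scaleStep (+ 2) M₂₂ (perOn-row₁ M 2 (3 ∷ Rᵧ) [] 2 R (cong (λ m → suc (suc m)) (sym length-R′)) [] (M₂₄ ∷ row₂-R′))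
          X₅ : P (2 ∷ 3 ∷ Rᵧ) (1 ∷ R) ≡ - P (3 ∷ Rᵧ) R
          X₅ = negateStep M₂₁ (perOn-column₁ M 1 R [] 2 (3 ∷ Rᵧ) [] (M₃₁ ∷ M₄₁ ∷ columnZeros (# 1) R′ᵧ-detached))

          Y₁ : P (1 ∷ 2 ∷ R) (1 ∷ 2 ∷ 3 ∷ Rᵧ) ≡ + 1 * P (2 ∷ R) (2 ∷ 3 ∷ Rᵧ) - P (2 ∷ R) (1 ∷ 3 ∷ Rᵧ)
          Y₁ = mixedStep (+ 1) M₁₁ M₁₂ (perOn-row₂ M 1 (2 ∷ R) [] 1 [] 2 (3 ∷ Rᵧ)
                 (cong (λ m → suc (suc (suc m))) length-R′) [] [] (M₁₃ ∷ M₁₄ ∷ rowZeros (# 1) R′ᵧ-detached))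
          Y₂ : P (2 ∷ R) (2 ∷ 3 ∷ Rᵧ) ≡ + 2 * P R (3 ∷ Rᵧ) - P R (2 ∷ Rᵧ)
          Y₂ = mixedStep (+ 2) M₂₂ M₂₃ (perOn-row₂ M 2 R [] 2 [] 3 Rᵧ
                 (cong (λ m → suc (suc m)) length-R′) [] [] (M₂₄ ∷ rowZeros (# 2) R′ᵧ-detached))
          Y₀ : P R (2 ∷ Rᵧ) ≡ 0ℤ
          Y₀ = perOn-zeroColumn M 2 R (2 ∷ Rᵧ) (here refl) (M₄₂ ∷ column₂-R′)
          Y₃ : P (2 ∷ R) (1 ∷ 3 ∷ Rᵧ) ≡ - P R (3 ∷ Rᵧ)
          Y₃ = negateStep M₂₁ (perOn-column₁ M 1 (3 ∷ Rᵧ) [] 2 R [] (M₄₁ ∷ column₁-R′))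

        perOn-corner : P (0 ∷ 1 ∷ 2 ∷ 3 ∷ R) (0 ∷ 1 ∷ 2 ∷ 3 ∷ R) ≡
          + 23 * A + + 6 * A₄ + + 10 * Aᵧ + + 3 * A₄ᵧ - + 3 * Z - + 3 * Zᵀ
        perOn-corner = rewiredCombination _ _ _ _ _ _ _ _ _ _ _ _ _ _ _ _ _ _ _ _ _ _ _ _ _ _
          row₀ path₁ path₂ path₃ column₀ X₁ X₂ X₃ X₄ X₅ (negateStep M₃₄ U₃)
          column₀ᵧ Y₁ Y₂ Y₀ Y₃ (negateStep M₄₃ V₃) pathᵧ₁ pathᵧ₂ pathᵧ₃

  expansion-comparison : ∀ {p p′ a a₄ aᵧ a₄ᵧ z zᵀ a′ a₄′ aᵧ′ a₄ᵧ′ z′ zᵀ′ : ℤ} →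
    p ≡ + 29 * a + + 12 * a₄ + + 12 * aᵧ + + 5 * a₄ᵧ - z - zᵀ →
    p′ ≡ + 23 * a′ + + 6 * a₄′ + + 10 * aᵧ′ + + 3 * a₄ᵧ′ - + 3 * z′ - + 3 * zᵀ′ →
    a′ ≡ a → a₄′ ≡ a₄ → aᵧ′ ≡ aᵧ → a₄ᵧ′ ≡ a₄ᵧ → z′ ≡ z → zᵀ′ ≡ zᵀ → z ≡ -1ℤ → zᵀ ≡ -1ℤ →
    1ℤ ≤ a → 0ℤ ≤ a₄ → 0ℤ ≤ aᵧ → 0ℤ ≤ a₄ᵧ → p′ < p
  expansion-comparison {a = a} {a₄} {aᵧ} {a₄ᵧ} refl refl refl refl refl refl refl refl refl refl 1≤a 0≤a₄ 0≤aᵧ 0≤a₄ᵧ =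
    subst (smaller <_) (sym (difference a a₄ aᵧ a₄ᵧ))
      (subst (_< smaller + gap) (+-identityʳ smaller) (+-monoʳ-< smaller 0<gap))
    where
      smaller gap : ℤ
      smaller = + 23 * a + + 6 * a₄ + + 10 * aᵧ + + 3 * a₄ᵧ - + 3 * -1ℤ - + 3 * -1ℤ
      gap     = + 6 * (a - 1ℤ) + + 6 * a₄ + + 2 * aᵧ + + 2 * a₄ᵧ + + 2
      difference : ∀ a a₄ aᵧ a₄ᵧ →
        + 29 * a + + 12 * a₄ + + 12 * aᵧ + + 5 * a₄ᵧ - -1ℤ - -1ℤ ≡
        (+ 23 * a + + 6 * a₄ + + 10 * aᵧ + + 3 * a₄ᵧ - + 3 * -1ℤ - + 3 * -1ℤ) + (+ 6 * (a - 1ℤ) + + 6 * a₄ + + 2 * aᵧ + + 2 * a₄ᵧ + + 2)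
      difference = solve-∀
      scaled : ∀ c {t} → 0ℤ ≤ t → 0ℤ ≤ + c * t
      scaled c {t} 0≤t = subst (_≤ + c * t) (*-zeroʳ (+ c)) (*-monoˡ-≤-nonNeg (+ c) 0≤t)
      0<gap : 0ℤ < gap
      0<gap = <-≤-trans (+<+ (s≤s z≤n))
        (+-monoˡ-≤ (+ 2) (+-mono-≤ (+-mono-≤ (+-mono-≤ (scaled 6 (+-monoˡ-≤ -1ℤ 1≤a)) (scaled 6 0≤a₄)) (scaled 2 0≤aᵧ)) (scaled 2 0≤a₄ᵧ)))

module CycleGraph where

  open import Data.Nat using (ℕ; zero; suc; _+_; _*_; _∸_; _≤_; _<_; z≤n; s≤s; _%_)
  import Data.Nat as ℕ
  open import Data.Nat.Properties using (≤-refl; ≤-trans; ≤-<-trans; <-≤-trans; <⇒≤; <-irrefl; n≤1+n; suc-injective; ≤-antisym; ≮⇒≥; m≤m+n; *-monoʳ-≤; ∸-monoˡ-≤)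
  open import Data.Nat.DivMod using (n%n≡0; m<n⇒m%n≡m)
  open import Data.Bool using (Bool; true; false; not; _∧_; _∨_; if_then_else_)
  open import Data.Bool.Properties using (∧-comm; ∨-comm; ∨-zeroʳ)
  open import Data.Product using (_×_; _,_; proj₁; proj₂)
  open import Data.Sum using (_⊎_; inj₁; inj₂)
  open import Data.Empty using (⊥-elim)
  open import Data.List using (List; iterate)
  open import Data.Fin using (zero; suc)
  open import Data.List.Relation.Unary.All using () renaming (universal to All-universal)
  open import Data.Integer using (ℤ; +_; 0ℤ; -1ℤ)
  open import Function using (_∘_)
  open import Relation.Nullary using (¬_; yes; no)
  open import Relation.Nullary.Decidable using (True; toWitness)
  open import Relation.Binary.PropositionalEquality using (_≡_; _≢_; refl; sym; trans; cong; cong₂; subst)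
  open import Defs using (cycArc; pendArc; adjℕ; sameEdge; _==_; _<ᵇ_)
  open LaplacianOnNat
  open CornerExpansion using (Detached)

  ∧≡true : ∀ {x y} → x ∧ y ≡ true → x ≡ true × y ≡ true
  ∧≡true {true} {true} _ = refl , refl

  ∨≡true : ∀ {x y} → x ∨ y ≡ true → x ≡ true ⊎ y ≡ true
  ∨≡true {true}  _  = inj₁ refl
  ∨≡true {false} eq = inj₂ eq

  ∨-introʳ : ∀ x {y} → y ≡ true → x ∨ y ≡ true
  ∨-introʳ true  _  = refl
  ∨-introʳ false eq = eq

  ∨≡false : ∀ {x y} → x ≡ false → y ≡ false → x ∨ y ≡ false
  ∨≡false refl refl = refl

  not≡true : ∀ {x} → not x ≡ true → x ≡ false
  not≡true {false} _ = refl

  ≢true : ∀ {x} → ¬ (x ≡ true) → x ≡ false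
  ≢true {true}  x≢true = ⊥-elim (x≢true refl)
  ≢true {false} _      = refl

  ≡-bool : ∀ {x y} → (x ≡ true → y ≡ true) → (y ≡ true → x ≡ true) → x ≡ y
  ≡-bool {true}  {true}  _ _ = refl
  ≡-bool {true}  {false} f _ = sym (f refl)
  ≡-bool {false} {true}  _ g = g refl
  ≡-bool {false} {false} _ _ = refl

  <ᵇfalse⇒≥ : ∀ {a b} → (a <ᵇ b) ≡ false → b ≤ a
  <ᵇfalse⇒≥ {a} {b} eq with a ℕ.<? b
  ... | no a≮b = ≮⇒≥ a≮b

  sameEdge-sym : ∀ p q a b → sameEdge p q a b ≡ sameEdge p q b a
  sameEdge-sym p q a b =
    trans (∨-comm ((a == p) ∧ (b == q)) ((a == q) ∧ (b == p)))
          (cong₂ _∨_ (∧-comm (a == q) (b == p)) (∧-comm (a == p) (b == q)))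

  suc[2m∸1]≡2m : ∀ m → 1 ≤ m → suc (2 * m ∸ 1) ≡ 2 * m
  suc[2m∸1]≡2m (suc m) _ = refl

  module CycleWithPendants (k i j ni nj : ℕ) (3≤k : 3 ≤ k) (4<i : 4 < i) (i<j : i < j) (j≤2k : j ≤ 2 * k) where

    K Y n cᵢ cⱼ : ℕ
    K  = 2 * k
    Y  = 2 * k ∸ 1
    n  = 2 * k + ni + nj
    cᵢ = i ∸ 1
    cⱼ = j ∸ 1

    adj adj′ : ℕ → ℕ → Bool
    adj = adjℕ k i j ni nj
    adj′ a b = (adj a b ∧ not (sameEdge 0 1 a b)) ∨ sameEdge 0 3 a b

    suc-Y : suc Y ≡ K
    suc-Y = suc[2m∸1]≡2m k (≤-trans (s≤s z≤n) 3≤k)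

    Y<K : Y < K
    Y<K = subst (Y <_) suc-Y ≤-refl

    5≤Y : 5 ≤ Y
    5≤Y = ∸-monoˡ-≤ 1 (*-monoʳ-≤ 2 3≤k)

    0<Y : 0 < Y
    0<Y = ≤-trans (s≤s z≤n) 5≤Y

    6≤K : 6 ≤ K
    6≤K = subst (6 ≤_) suc-Y (s≤s 5≤Y)

    K≤n : K ≤ n
    K≤n = ≤-trans (m≤m+n K ni) (m≤m+n (K + ni) nj)

    4≤cᵢ : 4 ≤ cᵢ
    4≤cᵢ = ∸-monoˡ-≤ 1 4<i

    cⱼ≤Y : cⱼ ≤ Y
    cⱼ≤Y = ∸-monoˡ-≤ 1 j≤2k

    cᵢ≤Y : cᵢ ≤ Y
    cᵢ≤Y = ∸-monoˡ-≤ 1 (≤-trans (<⇒≤ i<j) j≤2k)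

    centre : ℕ → ℕ
    centre a = if a <ᵇ K + ni then cᵢ else cⱼ

    centre-bounds : ∀ a → 4 ≤ centre a × centre a ≤ Y
    centre-bounds a with a <ᵇ K + ni
    ... | true  = 4≤cᵢ , cᵢ≤Y
    ... | false = ≤-trans 4≤cᵢ (∸-monoˡ-≤ 1 (<⇒≤ i<j)) , cⱼ≤Y

    centre<K : ∀ a → centre a < K
    centre<K a = ≤-<-trans (proj₂ (centre-bounds a)) Y<K

    CycleArc : ℕ → ℕ → Set
    CycleArc a b = a < K × b < K × ((suc a < K × b ≡ suc a) ⊎ (a ≡ Y × b ≡ 0))

    PendantArc : ℕ → ℕ → Set
    PendantArc a b = K ≤ a × a < n × b ≡ centre a

    Adjacent : ℕ → ℕ → Set
    Adjacent a b = CycleArc a b ⊎ CycleArc b a ⊎ PendantArc a b ⊎ PendantArc b a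

    private
      successor-mod : ∀ a → a < K → (suc a < K × suc a % suc Y ≡ suc a) ⊎ (a ≡ Y × suc a % suc Y ≡ 0)
      successor-mod a a<K with suc a ℕ.<? K
      ... | yes a+1<K = inj₁ (a+1<K , m<n⇒m%n≡m (subst (suc a <_) (sym suc-Y) a+1<K))
      ... | no  a+1≮K = inj₂ (a≡Y , subst (λ y → suc y % suc Y ≡ 0) (sym a≡Y) (n%n≡0 (suc Y)))
        where
          a≡Y : a ≡ Y
          a≡Y = suc-injective (≤-antisym (subst (suc a ≤_) (sym suc-Y) a<K) (subst (_≤ suc a) (sym suc-Y) (≮⇒≥ a+1≮K)))

      cycArc⇒CycleArc : ∀ {a b} → cycArc k a b ≡ true → CycleArc a b
      cycArc⇒CycleArc eq with ∧≡true eq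
      ... | a<K , rest with ∧≡true rest
      ... | b<K , b≡ with successor-mod _ (<ᵇ⇒< a<K)
      ... | inj₁ (a+1<K , mod) = <ᵇ⇒< a<K , <ᵇ⇒< b<K , inj₁ (a+1<K , trans (==⇒≡ b≡) mod)
      ... | inj₂ (a≡Y , mod)   = <ᵇ⇒< a<K , <ᵇ⇒< b<K , inj₂ (a≡Y , trans (==⇒≡ b≡) mod)

      CycleArc⇒cycArc : ∀ {a b} → CycleArc a b → cycArc k a b ≡ true
      CycleArc⇒cycArc {a} (a<K , b<K , arc) rewrite <⇒<ᵇ a<K | <⇒<ᵇ b<K with successor-mod a a<K | arc
      ... | inj₁ (_ , mod)      | inj₁ (_ , refl)    rewrite mod = ==-refl (suc a)
      ... | inj₁ (a+1<K , _)    | inj₂ (refl , refl) = ⊥-elim (<-irrefl suc-Y a+1<K)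
      ... | inj₂ (refl , _)     | inj₁ (a+1<K , _)   = ⊥-elim (<-irrefl suc-Y a+1<K)
      ... | inj₂ (_ , mod)      | inj₂ (_ , refl)    rewrite mod = refl

      pendArc⇒PendantArc : ∀ {a b} → pendArc k i j ni nj a b ≡ true → PendantArc a b
      pendArc⇒PendantArc {a} eq with ∨≡true eq
      ... | inj₁ first with ∧≡true first
      ... | K≤a , rest with ∧≡true rest
      ... | a<K+ni , b≡ = <ᵇfalse⇒≥ (not≡true K≤a) , <-≤-trans (<ᵇ⇒< a<K+ni) (m≤m+n (K + ni) nj) ,
                          trans (==⇒≡ b≡) (sym (cong (λ c → if c then cᵢ else cⱼ) a<K+ni))
      pendArc⇒PendantArc {a} eq | inj₂ second with ∧≡true second
      ... | K+ni≤a , rest with ∧≡true rest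
      ... | a<n , b≡ = ≤-trans (m≤m+n K ni) (<ᵇfalse⇒≥ (not≡true K+ni≤a)) , <ᵇ⇒< a<n ,
                       trans (==⇒≡ b≡) (sym (cong (λ c → if c then cᵢ else cⱼ) (not≡true K+ni≤a)))

      PendantArc⇒pendArc : ∀ {a b} → PendantArc a b → pendArc k i j ni nj a b ≡ true
      PendantArc⇒pendArc {a} (K≤a , a<n , refl) with a <ᵇ K + ni
      ... | true  rewrite ≮⇒<ᵇfalse {a} {K} (λ a<K → <-irrefl refl (<-≤-trans a<K K≤a)) | ==-refl cᵢ = refl
      ... | false rewrite <⇒<ᵇ a<n | ==-refl cⱼ = ∨-introʳ _ refl

    adj⇒Adjacent : ∀ {a b} → adj a b ≡ true → Adjacent a b
    adj⇒Adjacent eq with ∨≡true eq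
    ... | inj₁ arc = inj₁ (cycArc⇒CycleArc arc)
    ... | inj₂ rest with ∨≡true rest
    ... | inj₁ arc = inj₂ (inj₁ (cycArc⇒CycleArc arc))
    ... | inj₂ rest′ with ∨≡true rest′
    ... | inj₁ arc = inj₂ (inj₂ (inj₁ (pendArc⇒PendantArc arc)))
    ... | inj₂ arc = inj₂ (inj₂ (inj₂ (pendArc⇒PendantArc arc)))

    Adjacent⇒adj : ∀ {a b} → Adjacent a b → adj a b ≡ true
    Adjacent⇒adj {a} {b} (inj₁ arc) rewrite CycleArc⇒cycArc arc = refl
    Adjacent⇒adj {a} {b} (inj₂ (inj₁ arc)) rewrite CycleArc⇒cycArc arc = ∨-introʳ (cycArc k a b) refl
    Adjacent⇒adj {a} {b} (inj₂ (inj₂ (inj₁ arc))) rewrite PendantArc⇒pendArc arc =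
      ∨-introʳ (cycArc k a b) (∨-introʳ (cycArc k b a) refl)
    Adjacent⇒adj {a} {b} (inj₂ (inj₂ (inj₂ arc))) rewrite PendantArc⇒pendArc arc =
      ∨-introʳ (cycArc k a b) (∨-introʳ (cycArc k b a) (∨-introʳ (pendArc k i j ni nj a b) refl))

    Adjacent-sym : ∀ {a b} → Adjacent a b → Adjacent b a
    Adjacent-sym (inj₁ arc)               = inj₂ (inj₁ arc)
    Adjacent-sym (inj₂ (inj₁ arc))        = inj₁ arc
    Adjacent-sym (inj₂ (inj₂ (inj₁ arc))) = inj₂ (inj₂ (inj₂ arc))
    Adjacent-sym (inj₂ (inj₂ (inj₂ arc))) = inj₂ (inj₂ (inj₁ arc))

    adj-sym : ∀ a b → adj a b ≡ adj b a
    adj-sym a b = ≡-bool (Adjacent⇒adj ∘ Adjacent-sym ∘ adj⇒Adjacent) (Adjacent⇒adj ∘ Adjacent-sym ∘ adj⇒Adjacent)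

    adj′-sym : ∀ a b → adj′ a b ≡ adj′ b a
    adj′-sym a b rewrite adj-sym a b | sameEdge-sym 0 1 a b | sameEdge-sym 0 3 a b = refl

    adj-irrefl : ∀ a → adj a a ≡ false
    adj-irrefl a = ≢true (λ eq → noLoop (adj⇒Adjacent eq))
      where
        centre≢ : ∀ {b} → K ≤ b → b ≢ centre b
        centre≢ K≤b b≡ = <-irrefl refl (≤-<-trans K≤b (subst (_< K) (sym b≡) (centre<K _)))
        noLoop : ¬ Adjacent a a
        noLoop (inj₁ (_ , _ , inj₁ (_ , a≡a+1)))          = <-irrefl a≡a+1 ≤-refl
        noLoop (inj₁ (_ , _ , inj₂ (a≡Y , a≡0)))         = <-irrefl (trans (sym a≡0) a≡Y) 0<Y
        noLoop (inj₂ (inj₁ (_ , _ , inj₁ (_ , a≡a+1))))  = <-irrefl a≡a+1 ≤-refl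
        noLoop (inj₂ (inj₁ (_ , _ , inj₂ (a≡Y , a≡0)))) = <-irrefl (trans (sym a≡0) a≡Y) 0<Y
        noLoop (inj₂ (inj₂ (inj₁ (K≤a , _ , a≡))))      = centre≢ K≤a a≡
        noLoop (inj₂ (inj₂ (inj₂ (K≤a , _ , a≡))))      = centre≢ K≤a a≡

    small<K : ∀ {a} → a ≤ 5 → a < K
    small<K a≤5 = ≤-<-trans a≤5 6≤K

    small≢Y : ∀ {a} → a ≤ 4 → a ≢ Y
    small≢Y a≤4 refl = <-irrefl refl (≤-<-trans 5≤Y (s≤s a≤4))

    small≢centre : ∀ {a} b → a ≤ 3 → a ≢ centre b
    small≢centre b a≤3 refl = <-irrefl refl (≤-<-trans (proj₁ (centre-bounds b)) (s≤s a≤3))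

    small-not-pendant : ∀ {a} → a ≤ 5 → ¬ (K ≤ a)
    small-not-pendant a≤5 K≤a = <-irrefl refl (≤-<-trans K≤a (small<K a≤5))

    adj-v₁ : ∀ b → adj 0 b ≡ (b == 1) ∨ (b == Y)
    adj-v₁ b = ≡-bool to from
      where
        to : adj 0 b ≡ true → ((b == 1) ∨ (b == Y)) ≡ true
        to eq with adj⇒Adjacent eq
        ... | inj₁ (_ , _ , inj₁ (_ , refl))         = refl
        ... | inj₁ (_ , _ , inj₂ (0≡Y , _))          = ⊥-elim (small≢Y z≤n 0≡Y)
        ... | inj₂ (inj₁ (_ , _ , inj₁ (_ , ())))
        ... | inj₂ (inj₁ (_ , _ , inj₂ (refl , _)))  = ∨-introʳ (Y == 1) (==-refl Y)
        ... | inj₂ (inj₂ (inj₁ (K≤0 , _)))          = ⊥-elim (small-not-pendant z≤n K≤0)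
        ... | inj₂ (inj₂ (inj₂ (_ , _ , 0≡centre))) = ⊥-elim (small≢centre b z≤n 0≡centre)
        from : ((b == 1) ∨ (b == Y)) ≡ true → adj 0 b ≡ true
        from eq with ∨≡true {b == 1} eq
        ... | inj₁ b≡1 rewrite ==⇒≡ b≡1 = Adjacent⇒adj (inj₁ (small<K z≤n , small<K (s≤s z≤n) , inj₁ (small<K (s≤s z≤n) , refl)))
        ... | inj₂ b≡Y rewrite ==⇒≡ b≡Y = Adjacent⇒adj (inj₂ (inj₁ (Y<K , small<K z≤n , inj₂ (refl , refl))))

    adj-path : ∀ a → 1 ≤ a → a ≤ 3 → ∀ b → adj a b ≡ (b == a ∸ 1) ∨ (b == suc a)
    adj-path (suc a) (s≤s z≤n) a<3 b = ≡-bool to from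
      where
        a+1≤5 : suc a ≤ 5
        a+1≤5 = ≤-trans a<3 (s≤s (s≤s (s≤s z≤n)))
        to : adj (suc a) b ≡ true → ((b == a) ∨ (b == suc (suc a))) ≡ true
        to eq with adj⇒Adjacent eq
        ... | inj₁ (_ , _ , inj₁ (_ , refl))         = ∨-introʳ (suc (suc a) == a) (==-refl (suc (suc a)))
        ... | inj₁ (_ , _ , inj₂ (a+1≡Y , _))        = ⊥-elim (small≢Y (≤-trans a<3 (s≤s (s≤s (s≤s z≤n)))) a+1≡Y)
        ... | inj₂ (inj₁ (_ , _ , inj₁ (_ , refl)))  rewrite ==-refl a = refl
        ... | inj₂ (inj₁ (_ , _ , inj₂ (_ , ())))
        ... | inj₂ (inj₂ (inj₁ (K≤a+1 , _)))        = ⊥-elim (small-not-pendant a+1≤5 K≤a+1)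
        ... | inj₂ (inj₂ (inj₂ (_ , _ , a+1≡)))     = ⊥-elim (small≢centre b a<3 a+1≡)
        from : ((b == a) ∨ (b == suc (suc a))) ≡ true → adj (suc a) b ≡ true
        from eq with ∨≡true {b == a} eq
        ... | inj₁ b≡a   rewrite ==⇒≡ b≡a   =
          Adjacent⇒adj (inj₂ (inj₁ (small<K (≤-trans (n≤1+n a) a+1≤5) , small<K a+1≤5 , inj₁ (small<K a+1≤5 , refl))))
        ... | inj₂ b≡a+2 rewrite ==⇒≡ b≡a+2 =
          Adjacent⇒adj (inj₁ (small<K a+1≤5 , small<K (s≤s (≤-trans a<3 (s≤s (s≤s (s≤s z≤n))))) ,
                               inj₁ (small<K (s≤s (≤-trans a<3 (s≤s (s≤s (s≤s z≤n))))) , refl)))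

    adj′-v₁ : ∀ b → adj′ 0 b ≡ (b == 3) ∨ (b == Y)
    adj′-v₁ b = ≡-bool to from
      where
        to : adj′ 0 b ≡ true → ((b == 3) ∨ (b == Y)) ≡ true
        to eq with ∨≡true {adj 0 b ∧ not (sameEdge 0 1 0 b)} {sameEdge 0 3 0 b} eq
        ... | inj₂ v₁v₄ with ∨≡true {b == 3} {false} v₁v₄
        ...   | inj₁ b≡3 rewrite b≡3 = refl
        to eq | inj₁ kept with ∧≡true {adj 0 b} {not (sameEdge 0 1 0 b)} kept
        ...   | isadj , notv₁v₂ with ∨≡true {b == 1} {b == Y} (trans (sym (adj-v₁ b)) isadj)
        ...     | inj₁ b≡1 rewrite ==⇒≡ b≡1 = ⊥-elim (false≢true notv₁v₂)
          where
            false≢true : false ≢ true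
            false≢true ()
        ...     | inj₂ b≡Y = ∨-introʳ (b == 3) b≡Y
        from : ((b == 3) ∨ (b == Y)) ≡ true → adj′ 0 b ≡ true
        from eq with ∨≡true {b == 3} {b == Y} eq
        ... | inj₁ b≡3 rewrite ==⇒≡ b≡3 = ∨-introʳ (adj 0 3 ∧ not (sameEdge 0 1 0 3)) refl
        ... | inj₂ b≡Y rewrite ==⇒≡ b≡Y | adj-v₁ Y | ≢⇒==false (small≢Y {1} (s≤s z≤n) ∘ sym) | ==-refl Y = refl

    adj′-v₂ : ∀ b → adj′ 1 b ≡ (b == 2)
    adj′-v₂ b rewrite adj-path 1 (s≤s z≤n) (s≤s z≤n) b with b ℕ.≟ 0
    ... | yes refl = refl
    ... | no _ with b == 2
    ...   | true  = refl
    ...   | false = refl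

    adj′-v₃ : ∀ b → adj′ 2 b ≡ adj 2 b
    adj′-v₃ b with adj 2 b
    ... | true  = refl
    ... | false = refl

    adj′-v₄ : ∀ b → adj′ 3 b ≡ (b == 0) ∨ adj 3 b
    adj′-v₄ b with adj 3 b | b == 0
    ... | true  | true  = refl
    ... | true  | false = refl
    ... | false | true  = refl
    ... | false | false = refl

    adj′-beyond-v₄ : ∀ a b → 4 ≤ a → adj′ a b ≡ adj a b
    adj′-beyond-v₄ a b 4≤a
      rewrite ≢⇒==false {a} {0} (λ { refl → <-irrefl refl (≤-trans (s≤s z≤n) 4≤a) })
            | ≢⇒==false {a} {1} (λ { refl → <-irrefl refl (≤-trans (s≤s (s≤s z≤n)) 4≤a) })
            | ≢⇒==false {a} {3} (λ { refl → <-irrefl refl 4≤a }) with adj a b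
    ... | true  = refl
    ... | false = refl

    V : List ℕ
    V = iterate suc 0 n

    L L′ : ℕ → ℕ → ℤ
    L  = laplacianℕ V adj
    L′ = laplacianℕ V adj′

    small<n : ∀ {a} → a ≤ 5 → a < n
    small<n a≤5 = <-≤-trans (small<K a≤5) K≤n

    Y<n : Y < n
    Y<n = <-≤-trans Y<K K≤n

    private
      count-one : ∀ u → u < n → count (_== u) V ≡ 1
      count-one u u<n = count-single u 0 n z≤n u<n

      exclusive : ∀ u w → u ≢ w → ∀ b → (b == u) ≡ true → (b == w) ≡ false
      exclusive u w u≢w b b≡u = ≢⇒==false (λ b≡w → u≢w (trans (sym (==⇒≡ b≡u)) b≡w))

      count-two : ∀ u w → u ≢ w → u < n → w < n → count (λ b → (b == u) ∨ (b == w)) V ≡ 2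
      count-two u w u≢w u<n w<n
        rewrite count-∨ (_== u) (_== w) V (All-universal (exclusive u w u≢w) V) | count-one u u<n | count-one w w<n = refl

      count-three : ∀ u w z → u ≢ w → u ≢ z → w ≢ z → u < n → w < n → z < n →
                    count (λ b → (b == u) ∨ ((b == w) ∨ (b == z))) V ≡ 3
      count-three u w z u≢w u≢z w≢z u<n w<n z<n
        rewrite count-∨ (_== u) (λ b → (b == w) ∨ (b == z)) V
                  (All-universal (λ b b≡u → ∨≡false (exclusive u w u≢w b b≡u) (exclusive u z u≢z b b≡u)) V)
              | count-two w z w≢z w<n z<n | count-one u u<n = refl

    degree-v₁ : count (adj 0) V ≡ 2
    degree-v₁ = trans (count-cong V adj-v₁) (count-two 1 Y (small≢Y (s≤s z≤n)) (small<n (s≤s z≤n)) Y<n)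

    degree-path : ∀ a → 1 ≤ a → a ≤ 3 → count (adj a) V ≡ 2
    degree-path (suc a) 1≤a a<3 = trans (count-cong V (adj-path (suc a) 1≤a a<3))
      (count-two a (suc (suc a)) (λ a≡a+2 → <-irrefl a≡a+2 (n≤1+n (suc a)))
        (small<n (≤-trans (n≤1+n a) (≤-trans a<3 (s≤s (s≤s (s≤s z≤n))))))
        (small<n (s≤s (≤-trans a<3 (s≤s (s≤s (s≤s z≤n)))))))

    degree′-v₁ : count (adj′ 0) V ≡ 2
    degree′-v₁ = trans (count-cong V adj′-v₁) (count-two 3 Y (small≢Y (s≤s (s≤s (s≤s z≤n)))) (small<n (s≤s (s≤s (s≤s z≤n)))) Y<n)

    degree′-v₂ : count (adj′ 1) V ≡ 1
    degree′-v₂ = trans (count-cong V adj′-v₂) (count-one 2 (small<n (s≤s (s≤s z≤n))))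

    degree′-v₃ : count (adj′ 2) V ≡ 2
    degree′-v₃ = trans (count-cong V adj′-v₃) (degree-path 2 (s≤s z≤n) (s≤s (s≤s z≤n)))

    degree′-v₄ : count (adj′ 3) V ≡ 3
    degree′-v₄ = trans (count-cong V (λ b → trans (adj′-v₄ b) (cong ((b == 0) ∨_) (adj-path 3 (s≤s z≤n) ≤-refl b))))
      (count-three 0 2 4 (λ ()) (λ ()) (λ ()) (small<n z≤n) (small<n (s≤s (s≤s z≤n))) (small<n (s≤s (s≤s (s≤s (s≤s z≤n))))))

    private
      Y==_ : ∀ a {a≤4 : True (a ℕ.≤? 4)} → (Y == a) ≡ false
      (Y== a) {a≤4} = ≢⇒==false (small≢Y (toWitness a≤4) ∘ sym)

      _==Y : ∀ a {a≤4 : True (a ℕ.≤? 4)} → (a == Y) ≡ false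
      (a ==Y) {a≤4} = ≢⇒==false (small≢Y (toWitness a≤4))

      _≢Y : ∀ a {a≤4 : True (a ℕ.≤? 4)} → a ≢ Y
      (a ≢Y) {a≤4} = small≢Y (toWitness a≤4)

      Y≢_ : ∀ a {a≤4 : True (a ℕ.≤? 4)} → Y ≢ a
      (Y≢ a) {a≤4} = small≢Y (toWitness a≤4) ∘ sym

      large==small : ∀ {x} → 5 ≤ x → ∀ c {c≤4 : True (c ℕ.≤? 4)} → (x == c) ≡ false
      (large==small 5≤x c) {c≤4} = ≢⇒==false (λ { refl → <-irrefl refl (≤-<-trans 5≤x (s≤s (toWitness c≤4))) })

      small≢ : ∀ {x} → 5 ≤ x → ∀ c {c≤4 : True (c ℕ.≤? 4)} → c ≢ x
      (small≢ 5≤x c) {c≤4} refl = <-irrefl refl (≤-<-trans 5≤x (s≤s (toWitness c≤4)))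

      adj-flip : ∀ {a b v} → adj a b ≡ v → adj b a ≡ v
      adj-flip {a} {b} = trans (adj-sym b a)

      adj′-flip : ∀ {a b v} → adj′ a b ≡ v → adj′ b a ≡ v
      adj′-flip {a} {b} = trans (adj′-sym b a)

      adj-v₂ : ∀ b → adj 1 b ≡ (b == 0) ∨ (b == 2)
      adj-v₂ = adj-path 1 (s≤s z≤n) (s≤s z≤n)

      adj-v₃ : ∀ b → adj 2 b ≡ (b == 1) ∨ (b == 3)
      adj-v₃ = adj-path 2 (s≤s z≤n) (s≤s (s≤s z≤n))

      adj-v₄ : ∀ b → adj 3 b ≡ (b == 2) ∨ (b == 4)
      adj-v₄ = adj-path 3 (s≤s z≤n) ≤-refl

    adj-v₁v₂ₖ : adj 0 Y ≡ true
    adj-v₁v₂ₖ = trans (adj-v₁ Y) (trans (cong ((Y == 1) ∨_) (==-refl Y)) (∨-zeroʳ (Y == 1)))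

    adj′-v₁v₂ₖ : adj′ 0 Y ≡ true
    adj′-v₁v₂ₖ = trans (adj′-v₁ Y) (trans (cong (_∨ (Y == Y)) ((Y== 3))) (==-refl Y))

    L₀₀ : L 0 0 ≡ + 2
    L₀₀ = laplacianℕ-diagonal V adj (adj-irrefl 0) degree-v₁
    L₁₁ : L 1 1 ≡ + 2
    L₁₁ = laplacianℕ-diagonal V adj (adj-irrefl 1) (degree-path 1 (s≤s z≤n) (s≤s z≤n))
    L₂₂ : L 2 2 ≡ + 2
    L₂₂ = laplacianℕ-diagonal V adj (adj-irrefl 2) (degree-path 2 (s≤s z≤n) (s≤s (s≤s z≤n)))
    L₃₃ : L 3 3 ≡ + 2
    L₃₃ = laplacianℕ-diagonal V adj (adj-irrefl 3) (degree-path 3 (s≤s z≤n) ≤-refl)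

    L₀₁ : L 0 1 ≡ -1ℤ
    L₀₁ = laplacianℕ-adjacent V adj (λ ()) (adj-v₁ 1)
    L₁₀ : L 1 0 ≡ -1ℤ
    L₁₀ = laplacianℕ-adjacent V adj (λ ()) (adj-v₂ 0)
    L₁₂ : L 1 2 ≡ -1ℤ
    L₁₂ = laplacianℕ-adjacent V adj (λ ()) (adj-v₂ 2)
    L₂₁ : L 2 1 ≡ -1ℤ
    L₂₁ = laplacianℕ-adjacent V adj (λ ()) (adj-v₃ 1)
    L₂₃ : L 2 3 ≡ -1ℤ
    L₂₃ = laplacianℕ-adjacent V adj (λ ()) (adj-v₃ 3)
    L₃₂ : L 3 2 ≡ -1ℤ
    L₃₂ = laplacianℕ-adjacent V adj (λ ()) (adj-v₄ 2)
    L₃₄ : L 3 4 ≡ -1ℤ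
    L₃₄ = laplacianℕ-adjacent V adj (λ ()) (adj-v₄ 4)
    L₄₃ : L 4 3 ≡ -1ℤ
    L₄₃ = laplacianℕ-adjacent V adj (λ ()) (adj-flip (adj-v₄ 4))
    L₀ᵧ : L 0 Y ≡ -1ℤ
    L₀ᵧ = laplacianℕ-adjacent V adj (0 ≢Y) adj-v₁v₂ₖ
    Lᵧ₀ : L Y 0 ≡ -1ℤ
    Lᵧ₀ = laplacianℕ-adjacent V adj (Y≢ 0) (adj-flip adj-v₁v₂ₖ)

    L₀₂ : L 0 2 ≡ 0ℤ
    L₀₂ = laplacianℕ-nonadjacent V adj (λ ()) (trans (adj-v₁ 2) (2 ==Y))
    L₂₀ : L 2 0 ≡ 0ℤ
    L₂₀ = laplacianℕ-nonadjacent V adj (λ ()) (adj-v₃ 0)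
    L₀₃ : L 0 3 ≡ 0ℤ
    L₀₃ = laplacianℕ-nonadjacent V adj (λ ()) (trans (adj-v₁ 3) (3 ==Y))
    L₃₀ : L 3 0 ≡ 0ℤ
    L₃₀ = laplacianℕ-nonadjacent V adj (λ ()) (adj-v₄ 0)
    L₁₃ : L 1 3 ≡ 0ℤ
    L₁₃ = laplacianℕ-nonadjacent V adj (λ ()) (adj-v₂ 3)
    L₃₁ : L 3 1 ≡ 0ℤ
    L₃₁ = laplacianℕ-nonadjacent V adj (λ ()) (adj-v₄ 1)
    L₀₄ : L 0 4 ≡ 0ℤ
    L₀₄ = laplacianℕ-nonadjacent V adj (λ ()) (trans (adj-v₁ 4) (4 ==Y))
    L₄₀ : L 4 0 ≡ 0ℤ
    L₄₀ = laplacianℕ-nonadjacent V adj (λ ()) (adj-flip (trans (adj-v₁ 4) (4 ==Y)))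
    L₁₄ : L 1 4 ≡ 0ℤ
    L₁₄ = laplacianℕ-nonadjacent V adj (λ ()) (adj-v₂ 4)
    L₄₁ : L 4 1 ≡ 0ℤ
    L₄₁ = laplacianℕ-nonadjacent V adj (λ ()) (adj-flip (adj-v₂ 4))
    L₂₄ : L 2 4 ≡ 0ℤ
    L₂₄ = laplacianℕ-nonadjacent V adj (λ ()) (adj-v₃ 4)
    L₄₂ : L 4 2 ≡ 0ℤ
    L₄₂ = laplacianℕ-nonadjacent V adj (λ ()) (adj-flip (adj-v₃ 4))
    L₁ᵧ : L 1 Y ≡ 0ℤ
    L₁ᵧ = laplacianℕ-nonadjacent V adj (1 ≢Y) (trans (adj-v₂ Y) (∨≡false (Y== 0) (Y== 2)))
    Lᵧ₁ : L Y 1 ≡ 0ℤ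
    Lᵧ₁ = laplacianℕ-nonadjacent V adj (Y≢ 1) (adj-flip (trans (adj-v₂ Y) (∨≡false (Y== 0) (Y== 2))))
    L₂ᵧ : L 2 Y ≡ 0ℤ
    L₂ᵧ = laplacianℕ-nonadjacent V adj (2 ≢Y) (trans (adj-v₃ Y) (∨≡false (Y== 1) (Y== 3)))
    Lᵧ₂ : L Y 2 ≡ 0ℤ
    Lᵧ₂ = laplacianℕ-nonadjacent V adj (Y≢ 2) (adj-flip (trans (adj-v₃ Y) (∨≡false (Y== 1) (Y== 3))))
    L₃ᵧ : L 3 Y ≡ 0ℤ
    L₃ᵧ = laplacianℕ-nonadjacent V adj (3 ≢Y) (trans (adj-v₄ Y) (∨≡false (Y== 2) (Y== 4)))
    Lᵧ₃ : L Y 3 ≡ 0ℤ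
    Lᵧ₃ = laplacianℕ-nonadjacent V adj (Y≢ 3) (adj-flip (trans (adj-v₄ Y) (∨≡false (Y== 2) (Y== 4))))

    L′₀₀ : L′ 0 0 ≡ + 2
    L′₀₀ = laplacianℕ-diagonal V adj′ (trans (adj′-v₁ 0) (0 ==Y)) degree′-v₁
    L′₁₁ : L′ 1 1 ≡ + 1
    L′₁₁ = laplacianℕ-diagonal V adj′ (adj′-v₂ 1) degree′-v₂
    L′₂₂ : L′ 2 2 ≡ + 2
    L′₂₂ = laplacianℕ-diagonal V adj′ (trans (adj′-v₃ 2) (adj-irrefl 2)) degree′-v₃
    L′₃₃ : L′ 3 3 ≡ + 3
    L′₃₃ = laplacianℕ-diagonal V adj′ (trans (adj′-v₄ 3) (adj-irrefl 3)) degree′-v₄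

    L′₀₃ : L′ 0 3 ≡ -1ℤ
    L′₀₃ = laplacianℕ-adjacent V adj′ (λ ()) (adj′-v₁ 3)
    L′₃₀ : L′ 3 0 ≡ -1ℤ
    L′₃₀ = laplacianℕ-adjacent V adj′ (λ ()) (adj′-v₄ 0)
    L′₁₂ : L′ 1 2 ≡ -1ℤ
    L′₁₂ = laplacianℕ-adjacent V adj′ (λ ()) (adj′-v₂ 2)
    L′₂₁ : L′ 2 1 ≡ -1ℤ
    L′₂₁ = laplacianℕ-adjacent V adj′ (λ ()) (trans (adj′-v₃ 1) (adj-v₃ 1))
    L′₂₃ : L′ 2 3 ≡ -1ℤ
    L′₂₃ = laplacianℕ-adjacent V adj′ (λ ()) (trans (adj′-v₃ 3) (adj-v₃ 3))
    L′₃₂ : L′ 3 2 ≡ -1ℤ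
    L′₃₂ = laplacianℕ-adjacent V adj′ (λ ()) (trans (adj′-v₄ 2) (adj-v₄ 2))
    L′₃₄ : L′ 3 4 ≡ -1ℤ
    L′₃₄ = laplacianℕ-adjacent V adj′ (λ ()) (trans (adj′-v₄ 4) (adj-v₄ 4))
    L′₄₃ : L′ 4 3 ≡ -1ℤ
    L′₄₃ = laplacianℕ-adjacent V adj′ (λ ()) (adj′-flip (trans (adj′-v₄ 4) (adj-v₄ 4)))
    L′₀ᵧ : L′ 0 Y ≡ -1ℤ
    L′₀ᵧ = laplacianℕ-adjacent V adj′ (0 ≢Y) adj′-v₁v₂ₖ
    L′ᵧ₀ : L′ Y 0 ≡ -1ℤ
    L′ᵧ₀ = laplacianℕ-adjacent V adj′ (Y≢ 0) (adj′-flip adj′-v₁v₂ₖ)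

    L′₀₁ : L′ 0 1 ≡ 0ℤ
    L′₀₁ = laplacianℕ-nonadjacent V adj′ (λ ()) (trans (adj′-v₁ 1) (1 ==Y))
    L′₁₀ : L′ 1 0 ≡ 0ℤ
    L′₁₀ = laplacianℕ-nonadjacent V adj′ (λ ()) (adj′-v₂ 0)
    L′₀₂ : L′ 0 2 ≡ 0ℤ
    L′₀₂ = laplacianℕ-nonadjacent V adj′ (λ ()) (trans (adj′-v₁ 2) (2 ==Y))
    L′₂₀ : L′ 2 0 ≡ 0ℤ
    L′₂₀ = laplacianℕ-nonadjacent V adj′ (λ ()) (trans (adj′-v₃ 0) (adj-v₃ 0))
    L′₁₃ : L′ 1 3 ≡ 0ℤ
    L′₁₃ = laplacianℕ-nonadjacent V adj′ (λ ()) (adj′-v₂ 3)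
    L′₃₁ : L′ 3 1 ≡ 0ℤ
    L′₃₁ = laplacianℕ-nonadjacent V adj′ (λ ()) (trans (adj′-v₄ 1) (adj-v₄ 1))
    L′₀₄ : L′ 0 4 ≡ 0ℤ
    L′₀₄ = laplacianℕ-nonadjacent V adj′ (λ ()) (trans (adj′-v₁ 4) (4 ==Y))
    L′₄₀ : L′ 4 0 ≡ 0ℤ
    L′₄₀ = laplacianℕ-nonadjacent V adj′ (λ ()) (adj′-flip (trans (adj′-v₁ 4) (4 ==Y)))
    L′₁₄ : L′ 1 4 ≡ 0ℤ
    L′₁₄ = laplacianℕ-nonadjacent V adj′ (λ ()) (adj′-v₂ 4)
    L′₄₁ : L′ 4 1 ≡ 0ℤ
    L′₄₁ = laplacianℕ-nonadjacent V adj′ (λ ()) (adj′-flip (adj′-v₂ 4))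
    L′₂₄ : L′ 2 4 ≡ 0ℤ
    L′₂₄ = laplacianℕ-nonadjacent V adj′ (λ ()) (trans (adj′-v₃ 4) (adj-v₃ 4))
    L′₄₂ : L′ 4 2 ≡ 0ℤ
    L′₄₂ = laplacianℕ-nonadjacent V adj′ (λ ()) (adj′-flip (trans (adj′-v₃ 4) (adj-v₃ 4)))
    L′₁ᵧ : L′ 1 Y ≡ 0ℤ
    L′₁ᵧ = laplacianℕ-nonadjacent V adj′ (1 ≢Y) (trans (adj′-v₂ Y) (Y== 2))
    L′ᵧ₁ : L′ Y 1 ≡ 0ℤ
    L′ᵧ₁ = laplacianℕ-nonadjacent V adj′ (Y≢ 1) (adj′-flip (trans (adj′-v₂ Y) (Y== 2)))
    L′₂ᵧ : L′ 2 Y ≡ 0ℤ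
    L′₂ᵧ = laplacianℕ-nonadjacent V adj′ (2 ≢Y) (trans (adj′-v₃ Y) (trans (adj-v₃ Y) (∨≡false (Y== 1) (Y== 3))))
    L′ᵧ₂ : L′ Y 2 ≡ 0ℤ
    L′ᵧ₂ = laplacianℕ-nonadjacent V adj′ (Y≢ 2) (adj′-flip (trans (adj′-v₃ Y) (trans (adj-v₃ Y) (∨≡false (Y== 1) (Y== 3)))))
    L′₃ᵧ : L′ 3 Y ≡ 0ℤ
    L′₃ᵧ = laplacianℕ-nonadjacent V adj′ (3 ≢Y) (trans (adj′-v₄ Y) (∨≡false (Y== 0) (trans (adj-v₄ Y) (∨≡false (Y== 2) (Y== 4)))))
    L′ᵧ₃ : L′ Y 3 ≡ 0ℤ
    L′ᵧ₃ = laplacianℕ-nonadjacent V adj′ (Y≢ 3) (adj′-flip (trans (adj′-v₄ Y) (∨≡false (Y== 0) (trans (adj-v₄ Y) (∨≡false (Y== 2) (Y== 4))))))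

    private
      vanishing : ∀ {f} → (∀ a b → f a b ≡ f b a) → ∀ {a x} → a ≢ x → f a x ≡ false →
                  laplacianℕ V f a x ≡ 0ℤ × laplacianℕ V f x a ≡ 0ℤ
      vanishing {f} f-sym {a} {x} a≢x nonadj =
        laplacianℕ-nonadjacent V f a≢x nonadj , laplacianℕ-nonadjacent V f (a≢x ∘ sym) (trans (f-sym x a) nonadj)

    detached : ∀ {x} → 5 ≤ x → x ≢ Y → Detached L x
    detached 5≤x x≢Y zero =
      vanishing adj-sym (small≢ 5≤x 0) (trans (adj-v₁ _) (∨≡false (large==small 5≤x 1) (≢⇒==false x≢Y)))
    detached 5≤x x≢Y (suc zero) =
      vanishing adj-sym (small≢ 5≤x 1) (trans (adj-v₂ _) (∨≡false (large==small 5≤x 0) (large==small 5≤x 2)))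
    detached 5≤x x≢Y (suc (suc zero)) =
      vanishing adj-sym (small≢ 5≤x 2) (trans (adj-v₃ _) (∨≡false (large==small 5≤x 1) (large==small 5≤x 3)))
    detached 5≤x x≢Y (suc (suc (suc zero))) =
      vanishing adj-sym (small≢ 5≤x 3) (trans (adj-v₄ _) (∨≡false (large==small 5≤x 2) (large==small 5≤x 4)))

    detached′ : ∀ {x} → 5 ≤ x → x ≢ Y → Detached L′ x
    detached′ 5≤x x≢Y zero =
      vanishing adj′-sym (small≢ 5≤x 0) (trans (adj′-v₁ _) (∨≡false (large==small 5≤x 3) (≢⇒==false x≢Y)))
    detached′ 5≤x x≢Y (suc zero) =
      vanishing adj′-sym (small≢ 5≤x 1) (trans (adj′-v₂ _) (large==small 5≤x 2))
    detached′ 5≤x x≢Y (suc (suc zero)) =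
      vanishing adj′-sym (small≢ 5≤x 2) (trans (adj′-v₃ _) (trans (adj-v₃ _) (∨≡false (large==small 5≤x 1) (large==small 5≤x 3))))
    detached′ 5≤x x≢Y (suc (suc (suc zero))) =
      vanishing adj′-sym (small≢ 5≤x 3)
        (trans (adj′-v₄ _) (∨≡false (large==small 5≤x 0) (trans (adj-v₄ _) (∨≡false (large==small 5≤x 2) (large==small 5≤x 4)))))

    L′≡L : ∀ a b → 4 ≤ a → L′ a b ≡ L a b
    L′≡L a b 4≤a rewrite count-cong {adj′ a} {adj a} V (λ c → adj′-beyond-v₄ a c 4≤a) | adj′-beyond-v₄ a b 4≤a = refl

module Comparison where

  open import Data.Nat using (ℕ; zero; suc; _+_; _*_; _∸_; _≤_; _<_; z≤n; s≤s)
  import Data.Nat as ℕ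
  open import Data.Nat.Properties using (≤-refl; ≤-trans; <-trans; <-≤-trans; <-irrefl; n≤1+n; +-suc; +-assoc; m≤m+n; m+[n∸m]≡n; m+n∸m≡n; +-comm; suc-injective; ≤-antisym; ≮⇒≥; ≰⇒>)
  open import Data.Nat.Tactic.RingSolver using (solve-∀)
  open import Data.Bool using (Bool; true; false; not; _xor_; if_then_else_)
  open import Data.Bool.Properties using (xor-comm; xor-same; xor-inverseˡ; xor-inverseʳ)
  open import Data.Product using (_×_; _,_; proj₂; map₂)
  open import Data.Sum using (_⊎_; inj₁; inj₂)
  open import Data.Empty using (⊥-elim)
  open import Data.List using (List; []; _∷_; _++_; map; iterate)
  open import Data.List.Properties using (++-assoc)
  open import Data.List.Relation.Unary.All using (All; []; _∷_)
  import Data.List.Relation.Unary.All as All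
  open import Data.List.Relation.Unary.All.Properties using (++⁺)
  open import Data.List.Relation.Unary.Any using (Any)
  open import Data.List.Relation.Unary.Any.Properties using (++⁺ʳ)
  open import Data.List.Relation.Unary.AllPairs using (AllPairs)
  import Data.List.Relation.Unary.AllPairs as AllPairs
  import Data.List.Relation.Unary.AllPairs.Properties as AllPairs
  open import Data.Integer using (ℤ; +_; 0ℤ; 1ℤ; -1ℤ; +≤+; -≤+)
  import Data.Integer as ℤ
  import Data.Integer.Properties as ℤ
  open import Data.Integer using () renaming (_<_ to _<ℤ_)
  open import Data.Integer.Properties using (*-zeroˡ; *-zeroʳ; +-identityʳ)
  open import Relation.Nullary using (¬_; Dec; yes; no)
  open import Relation.Binary.PropositionalEquality using (_≡_; _≢_; refl; sym; trans; cong; cong₂; subst; subst₂; module ≡-Reasoning)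
  open import Defs using (_==_; _<ᵇ_; per; laplacian; graphG; graphG')
  open Permanent
  open LaplacianOnNat
  open SignPattern using (HasSign; HasSign-0; perOn-principal-nonneg; ∏diagonal≤perOn)
  open CornerExpansion using (module Corner; Detached; expansion-comparison)
  open CycleGraph
  open import Function using (_∘_)

  odd : ℕ → Bool
  odd zero    = false
  odd (suc m) = not (odd m)

  odd-double : ∀ m → odd (m + m) ≡ false
  odd-double zero    = refl
  odd-double (suc m) rewrite +-suc m m | odd-double m = refl

  ∏-≥1 : ∀ {f : ℕ → ℤ} xs → All (λ x → 1ℤ ℤ.≤ f x) xs → 1ℤ ℤ.≤ ∏ f xs
  ∏-≥1 []       []           = ℤ.≤-refl
  ∏-≥1 (x ∷ xs) (1≤fx ∷ 1≤f) = *-≥1 1≤fx (∏-≥1 xs 1≤f)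
    where
      *-≥1 : ∀ {u v} → 1ℤ ℤ.≤ u → 1ℤ ℤ.≤ v → 1ℤ ℤ.≤ u ℤ.* v
      *-≥1 {+ suc u} {+ suc v} (+≤+ (s≤s _)) (+≤+ (s≤s _)) = +≤+ (s≤s z≤n)

  module Estimates (k i j ni nj : ℕ) (3≤k : 3 ≤ k) (4<i : 4 < i) (i<j : i < j) (j≤2k : j ≤ 2 * k) where

    open CycleWithPendants k i j ni nj 3≤k 4<i i<j j≤2k

    pendants : List ℕ
    pendants = iterate suc K (ni + nj)

    pendants-bounds : All (λ r → K ≤ r × r < n) pendants
    pendants-bounds = All.map (λ {r} (K≤r , r<) → K≤r , subst (r <_) (sym (+-assoc K ni nj)) r<) (iterate-bounds K (ni + nj))

    pendant-nonadjacent : ∀ r s → K ≤ r → s ≢ centre r → adj s r ≡ false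
    pendant-nonadjacent r s K≤r s≢centre = ≢true (λ eq → notAdjacent (adj⇒Adjacent eq))
      where
        notAdjacent : ¬ Adjacent s r
        notAdjacent (inj₁ (_ , r<K , _))                 = <-irrefl refl (<-≤-trans r<K K≤r)
        notAdjacent (inj₂ (inj₁ (r<K , _ , _)))          = <-irrefl refl (<-≤-trans r<K K≤r)
        notAdjacent (inj₂ (inj₂ (inj₁ (_ , _ , r≡))))    = <-irrefl refl (<-≤-trans (subst (_< K) (sym r≡) (centre<K s)) K≤r)
        notAdjacent (inj₂ (inj₂ (inj₂ (_ , _ , s≡))))    = s≢centre s≡

    L-pendantColumn : ∀ r s → K ≤ r → s ≢ r → s ≢ centre r → L s r ≡ 0ℤ
    L-pendantColumn r s K≤r s≢r s≢centre = laplacianℕ-nonadjacent V adj s≢r (pendant-nonadjacent r s K≤r s≢centre)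

    cycle-nonadjacent : ∀ a b → suc (suc a) ≤ b → b < K → 1 ≤ a → adj b a ≡ false
    cycle-nonadjacent a b a+2≤b b<K 1≤a = ≢true (λ eq → notAdjacent (adj⇒Adjacent eq))
      where
        a≢0 : a ≢ 0
        a≢0 a≡0 = <-irrefl (sym a≡0) 1≤a
        notAdjacent : ¬ Adjacent b a
        notAdjacent (inj₁ (_ , _ , inj₁ (_ , refl)))          = <-irrefl refl (<-trans (n≤1+n (suc b)) a+2≤b)
        notAdjacent (inj₁ (_ , _ , inj₂ (_ , a≡0)))           = a≢0 a≡0
        notAdjacent (inj₂ (inj₁ (_ , _ , inj₁ (_ , refl))))   = <-irrefl refl a+2≤b
        notAdjacent (inj₂ (inj₁ (_ , _ , inj₂ (_ , b≡0))))    = <-irrefl (sym b≡0) (≤-trans (s≤s z≤n) a+2≤b)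
        notAdjacent (inj₂ (inj₂ (inj₁ (K≤b , _ , _))))        = <-irrefl refl (<-≤-trans b<K K≤b)
        notAdjacent (inj₂ (inj₂ (inj₂ (K≤a , _ , _))))        = <-irrefl refl (<-≤-trans (<-trans (≤-trans (n≤1+n (suc a)) a+2≤b) b<K) K≤a)

    pendant-degree : ∀ r → K ≤ r → r < n → count (adj r) V ≡ 1
    pendant-degree r K≤r r<n = trans (count-cong V (λ b → ≡-bool (to b) (from b))) (count-single (centre r) 0 n z≤n (<-≤-trans (centre<K r) K≤n))
      where
        to : ∀ b → adj r b ≡ true → (b == centre r) ≡ true
        to b eq with adj⇒Adjacent eq
        ... | inj₁ (r<K , _ , _)                  = ⊥-elim (<-irrefl refl (<-≤-trans r<K K≤r))
        ... | inj₂ (inj₁ (_ , r<K , _))           = ⊥-elim (<-irrefl refl (<-≤-trans r<K K≤r))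
        ... | inj₂ (inj₂ (inj₁ (_ , _ , b≡)))     rewrite b≡ = ==-refl (centre r)
        ... | inj₂ (inj₂ (inj₂ (_ , _ , r≡)))     = ⊥-elim (<-irrefl refl (<-≤-trans (subst (_< K) (sym r≡) (centre<K b)) K≤r))
        from : ∀ b → (b == centre r) ≡ true → adj r b ≡ true
        from b eq rewrite ==⇒≡ eq = Adjacent⇒adj (inj₂ (inj₂ (inj₁ (K≤r , r<n , refl))))

    perOn-pendants : perOn L pendants pendants ≡ 1ℤ
    perOn-pendants =
      trans (perOn-diagonal L (λ r → K ≤ r × r < n) offDiagonal pendants pendants-bounds
               (AllPairs.map (λ r<s r≡s → <-irrefl r≡s r<s) (iterate-increasing K (ni + nj))))
            (∏-one pendants (All.map (λ (K≤r , r<n) → laplacianℕ-diagonal V adj (adj-irrefl _) (pendant-degree _ K≤r r<n)) pendants-bounds))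
      where
        offDiagonal : ∀ a b → K ≤ a × a < n → K ≤ b × b < n → a ≢ b → L a b ≡ 0ℤ
        offDiagonal a b (K≤a , _) (K≤b , _) a≢b =
          L-pendantColumn b a K≤b a≢b (λ a≡ → <-irrefl refl (<-≤-trans (subst (_< K) (sym a≡) (centre<K b)) K≤a))
        ∏-one : ∀ xs → All (λ r → L r r ≡ + 1) xs → ∏ (λ r → L r r) xs ≡ 1ℤ
        ∏-one []       []         = refl
        ∏-one (x ∷ xs) (eq ∷ eqs) rewrite eq | ∏-one xs eqs = refl

    Beyond : ℕ → ℕ → Set
    Beyond m r = (suc (suc m) ≤ r × r < K) ⊎ (K ≤ r × r < n)

    -- L r m ≠ 0 only for a pendant r attached to m, and then column r of the remaining minor vanishes
    beyondTerm-vanishes : ∀ m d → 4 ≤ m → suc m < K → (r : ℕ) (rs : List ℕ) →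
      Beyond m r → All (Beyond m) rs → All (_≢ r) rs →
      L r m ℤ.* perOn L (suc m ∷ rs) (iterate suc (suc m) d ++ pendants) ≡ 0ℤ
    beyondTerm-vanishes m d 4≤m m+1<K r rs (inj₁ (m+2≤r , r<K)) _ _ =
      trans (cong (ℤ._* _) (laplacianℕ-nonadjacent V adj (λ r≡m → <-irrefl (sym r≡m) (<-trans ≤-refl m+2≤r))
                              (cycle-nonadjacent m r m+2≤r r<K (≤-trans (s≤s z≤n) 4≤m))))
            (*-zeroˡ (perOn L (suc m ∷ rs) (iterate suc (suc m) d ++ pendants)))
    beyondTerm-vanishes m d 4≤m m+1<K r rs (inj₂ (K≤r , r<n)) rs-beyond rs≢r with m ℕ.≟ centre r
    ... | no m≢centre =
      trans (cong (ℤ._* _) (laplacianℕ-nonadjacent V adj (λ r≡m → <-irrefl (sym r≡m) (<-≤-trans m<K K≤r))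
                              (trans (adj-sym r m) (pendant-nonadjacent r m K≤r m≢centre))))
            (*-zeroˡ (perOn L (suc m ∷ rs) (iterate suc (suc m) d ++ pendants)))
      where
        m<K : m < K
        m<K = <-trans ≤-refl m+1<K
    ... | yes m≡centre =
      trans (cong (L r m ℤ.*_) (perOn-zeroColumn L r (suc m ∷ rs) _ r∈columns (row-m+1 ∷ All.zipWith rowZero (rs-beyond , rs≢r))))
            (*-zeroʳ (L r m))
      where
        r∈columns : Any (r ≡_) (iterate suc (suc m) d ++ pendants)
        r∈columns = ++⁺ʳ (iterate suc (suc m) d) (iterate-any K (ni + nj) r K≤r (subst (r <_) (+-assoc K ni nj) r<n) refl)
        ≢centre : ∀ {s} → suc m ≤ s → s ≢ centre r
        ≢centre m<s s≡ = <-irrefl (trans m≡centre (sym s≡)) m<s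
        row-m+1 : L (suc m) r ≡ 0ℤ
        row-m+1 = L-pendantColumn r (suc m) K≤r (λ m+1≡r → <-irrefl m+1≡r (<-≤-trans m+1<K K≤r)) (≢centre ≤-refl)
        rowZero : ∀ {s} → Beyond m s × s ≢ r → L s r ≡ 0ℤ
        rowZero (inj₁ (m+2≤s , _) , s≢r) = L-pendantColumn r _ K≤r s≢r (≢centre (<-trans ≤-refl m+2≤s))
        rowZero (inj₂ (K≤s , _) , s≢r)   = L-pendantColumn r _ K≤r s≢r (≢centre (<-≤-trans (<-trans ≤-refl m+1<K) K≤s))

    -- rows v_{m+2}, …, v₂ₖ and columns v_{m+1}, …, v₂ₖ₋₁, each together with all pendants
    perOn-path : ∀ d m → 4 ≤ m → m + d ≡ Y →
      perOn L (iterate suc (suc m) d ++ pendants) (iterate suc m d ++ pendants) ≡ -1ℤ ℤ.^ d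
    perOn-path zero    m _   _   = perOn-pendants
    perOn-path (suc d) m 4≤m m+d+1≡Y = begin
        L (suc m) m ℤ.* perOn L rest columns ℤ.+ ∑ _ (map (map₂ (suc m ∷_)) (deletions rest))
      ≡⟨ cong₂ ℤ._+_ (cong₂ ℤ._*_ L-m+1-m (perOn-path d (suc m) (≤-trans 4≤m (n≤1+n m)) (trans (sym (+-suc m d)) m+d+1≡Y)))
                     (trans (∑-map _ (map₂ (suc m ∷_)) (deletions rest))
                            (∑-zero-on _ (deletions rest) (All.zip (deletions-removed rest-beyond , All.zip (deletions-remaining rest-beyond , deletions-fresh rest-distinct)))
                               (λ (r , rs) (r-beyond , rs-beyond , rs≢r) → beyondTerm-vanishes m d 4≤m m+1<K r rs r-beyond rs-beyond rs≢r))) ⟩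
        -1ℤ ℤ.^ suc d ℤ.+ 0ℤ
      ≡⟨ +-identityʳ _ ⟩
        -1ℤ ℤ.^ suc d ∎
      where
        open ≡-Reasoning
        rest columns : List ℕ
        rest    = iterate suc (suc (suc m)) d ++ pendants
        columns = iterate suc (suc m) d ++ pendants
        m+2+d≡K : suc (suc m) + d ≡ K
        m+2+d≡K = trans (cong suc (trans (sym (+-suc m d)) m+d+1≡Y)) suc-Y
        m+1<K : suc m < K
        m+1<K = subst (suc m <_) m+2+d≡K (s≤s (m≤m+n (suc m) d))
        L-m+1-m : L (suc m) m ≡ -1ℤ
        L-m+1-m = laplacianℕ-adjacent V adj (λ m+1≡m → <-irrefl (sym m+1≡m) ≤-refl)
                    (Adjacent⇒adj (inj₂ (inj₁ (<-trans ≤-refl m+1<K , m+1<K , inj₁ (m+1<K , refl)))))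
        rest-beyond : All (Beyond m) rest
        rest-beyond = ++⁺ (All.map (λ {r} (m+2≤r , r<) → inj₁ (m+2≤r , subst (r <_) m+2+d≡K r<)) (iterate-bounds (suc (suc m)) d))
                          (All.map inj₂ pendants-bounds)
        rest-distinct : AllPairs _≢_ rest
        rest-distinct = AllPairs.map (λ r<s r≡s → <-irrefl r≡s r<s)
          (AllPairs.++⁺ (iterate-increasing (suc (suc m)) d) (iterate-increasing K (ni + nj))
            (All.map (λ {r} (_ , r<) → All.map (λ (K≤s , _) → <-≤-trans (subst (r <_) m+2+d≡K r<) K≤s) (iterate-bounds K (ni + nj)))
                     (iterate-bounds (suc (suc m)) d)))

    L-sym : ∀ a b → L a b ≡ L b a
    L-sym a b = bySymmetry (a ℕ.≟ b)
      where
        bySymmetry : Dec (a ≡ b) → L a b ≡ L b a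
        bySymmetry (yes refl) = refl
        bySymmetry (no a≢b) rewrite ≢⇒==false a≢b | ≢⇒==false (a≢b ∘ sym) | adj-sym a b = refl

    Y≡5+[t+t] : Y ≡ 5 + ((k ∸ 3) + (k ∸ 3))
    Y≡5+[t+t] = suc-injective (trans suc-Y (double k 3≤k))
      where
        double : ∀ m → 3 ≤ m → 2 * m ≡ 6 + ((m ∸ 3) + (m ∸ 3))
        double (suc (suc zero)) (s≤s (s≤s ()))
        double (suc (suc (suc t))) _                   = lemma t
          where
            lemma : ∀ t → 2 * (3 + t) ≡ 6 + (t + t)
            lemma = solve-∀

    -- the cycle has even length, so colouring vertices by parity makes G bipartite
    colour : ℕ → Bool
    colour a = if a <ᵇ K then odd a else not (odd (centre a))

    colour-cycle : ∀ {a} → a < K → colour a ≡ odd a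
    colour-cycle a<K rewrite <⇒<ᵇ a<K = refl

    colour-pendant : ∀ {a} → K ≤ a → colour a ≡ not (odd (centre a))
    colour-pendant K≤a rewrite ≮⇒<ᵇfalse (λ a<K → <-irrefl refl (<-≤-trans a<K K≤a)) = refl

    odd-Y : odd Y ≡ true
    odd-Y rewrite Y≡5+[t+t] | odd-double (k ∸ 3) = refl

    cycle-colours : ∀ {a b} → CycleArc a b → colour a xor colour b ≡ true
    cycle-colours {a} (a<K , b<K , inj₁ (_ , refl)) rewrite colour-cycle a<K | colour-cycle b<K = xor-inverseʳ (odd a)
    cycle-colours     (a<K , b<K , inj₂ (refl , refl)) rewrite colour-cycle a<K | colour-cycle b<K | odd-Y = refl

    pendant-colours : ∀ {a b} → PendantArc a b → colour a xor colour b ≡ true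
    pendant-colours {a} (K≤a , _ , refl) rewrite colour-pendant K≤a | colour-cycle (centre<K a) = xor-inverseˡ (odd (centre a))

    adjacent-colours : ∀ {a b} → adj a b ≡ true → colour a xor colour b ≡ true
    adjacent-colours eq with adj⇒Adjacent eq
    ... | inj₁ arc               = cycle-colours arc
    ... | inj₂ (inj₁ arc)        = trans (xor-comm (colour _) (colour _)) (cycle-colours arc)
    ... | inj₂ (inj₂ (inj₁ arc)) = pendant-colours arc
    ... | inj₂ (inj₂ (inj₂ arc)) = trans (xor-comm (colour _) (colour _)) (pendant-colours arc)

    L-signPattern : ∀ a b → HasSign (colour a xor colour b) (L a b)
    L-signPattern a b = bySign (a ℕ.≟ b)
      where
        bySign : Dec (a ≡ b) → HasSign (colour a xor colour b) (L a b)
        bySign (yes refl) = subst₂ HasSign (sym (xor-same (colour a))) (sym (laplacianℕ-diagonal V adj (adj-irrefl a) refl)) (+≤+ z≤n)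
        bySign (no a≢b) = byAdjacency (adj a b) refl
          where
            byAdjacency : (v : Bool) → adj a b ≡ v → HasSign (colour a xor colour b) (L a b)
            byAdjacency true  eq = subst₂ HasSign (sym (adjacent-colours eq)) (sym (laplacianℕ-adjacent V adj a≢b eq)) -≤+
            byAdjacency false eq = subst (HasSign (colour a xor colour b)) (sym (laplacianℕ-nonadjacent V adj a≢b eq)) (HasSign-0 _)

    has-neighbour : ∀ a → a < n → Any (λ b → adj a b ≡ true) V
    has-neighbour a a<n with K ℕ.≤? a
    ... | yes K≤a = iterate-any 0 n (centre a) z≤n (<-≤-trans (centre<K a) K≤n) (Adjacent⇒adj (inj₂ (inj₂ (inj₁ (K≤a , a<n , refl)))))
    ... | no K≰a with suc a ℕ.<? K
    ...   | yes a+1<K = iterate-any 0 n (suc a) z≤n (<-≤-trans a+1<K K≤n)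
                          (Adjacent⇒adj (inj₁ (<-trans ≤-refl a+1<K , a+1<K , inj₁ (a+1<K , refl))))
    ...   | no a+1≮K  = iterate-any 0 n 0 z≤n (small<n z≤n) (Adjacent⇒adj (inj₁ (a<K , small<K z≤n , inj₂ (a≡Y , refl))))
      where
        a<K : a < K
        a<K = ≰⇒> K≰a
        a≡Y : a ≡ Y
        a≡Y = suc-injective (trans (≤-antisym a<K (≮⇒≥ a+1≮K)) (sym suc-Y))

    L-diagonal≥1 : ∀ a → a < n → 1ℤ ℤ.≤ L a a
    L-diagonal≥1 a a<n = subst (1ℤ ℤ.≤_) (sym (laplacianℕ-diagonal V adj (adj-irrefl a) refl))
                           (+≤+ (count-pos (adj a) V (has-neighbour a a<n)))

    interior : List ℕ
    interior = iterate suc 5 (Y ∸ 5)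

    5+[Y∸5]≡Y : 5 + (Y ∸ 5) ≡ Y
    5+[Y∸5]≡Y = m+[n∸m]≡n 5≤Y

    interior-bounds : All (λ x → 5 ≤ x × x < Y) interior
    interior-bounds = All.map (λ {x} (5≤x , x<) → 5≤x , subst (x <_) 5+[Y∸5]≡Y x<) (iterate-bounds 5 (Y ∸ 5))

    module G  = Corner L  Y interior pendants
    module G′ = Corner L′ Y interior pendants

    V≡ : V ≡ 0 ∷ 1 ∷ 2 ∷ 3 ∷ G.R
    V≡ = trans (cong (iterate suc 0) n≡) (cong (λ l → 0 ∷ 1 ∷ 2 ∷ 3 ∷ 4 ∷ l)
           (trans (iterate-++ 5 (Y ∸ 5) (suc (ni + nj)))
             (trans (cong (λ y → interior ++ iterate suc y (suc (ni + nj))) 5+[Y∸5]≡Y)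
                    (cong (λ y → interior ++ Y ∷ iterate suc y (ni + nj)) suc-Y))))
      where
        open ≡-Reasoning
        n≡ : n ≡ 5 + ((Y ∸ 5) + suc (ni + nj))
        n≡ = sym (begin
          5 + ((Y ∸ 5) + suc (ni + nj)) ≡⟨ sym (+-assoc 5 (Y ∸ 5) (suc (ni + nj))) ⟩
          5 + (Y ∸ 5) + suc (ni + nj)   ≡⟨ cong (_+ suc (ni + nj)) 5+[Y∸5]≡Y ⟩
          Y + suc (ni + nj)             ≡⟨ +-suc Y (ni + nj) ⟩
          suc Y + (ni + nj)             ≡⟨ cong (_+ (ni + nj)) suc-Y ⟩
          K + (ni + nj)                 ≡⟨ sym (+-assoc K ni nj) ⟩
          n ∎)

    interior-detached : ∀ {M} → (∀ {x} → 5 ≤ x → x ≢ Y → Detached M x) → All (Detached M) interior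
    interior-detached detachedM = All.map (λ (5≤x , x<Y) → detachedM 5≤x (λ x≡Y → <-irrefl x≡Y x<Y)) interior-bounds

    pendants-detached : ∀ {M} → (∀ {x} → 5 ≤ x → x ≢ Y → Detached M x) → All (Detached M) pendants
    pendants-detached detachedM =
      All.map (λ (K≤x , _) → detachedM (≤-trans (n≤1+n 5) (≤-trans 6≤K K≤x)) (λ { refl → <-irrefl refl (<-≤-trans Y<K K≤x) }))
              pendants-bounds

    perOn-G : perOn L V V ≡ + 29 ℤ.* G.A ℤ.+ + 12 ℤ.* G.A₄ ℤ.+ + 12 ℤ.* G.Aᵧ ℤ.+ + 5 ℤ.* G.A₄ᵧ ℤ.- G.Z ℤ.- G.Zᵀ
    perOn-G = trans (cong (λ W → perOn L W W) V≡)
      (G.Cycle.perOn-corner (interior-detached {L} detached) (pendants-detached {L} detached)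
         L₀₂ L₂₀ L₁₃ L₃₁ L₀₄ L₄₀ L₁₄ L₄₁ L₂₄ L₄₂ L₁ᵧ Lᵧ₁ L₂ᵧ Lᵧ₂ L₃ᵧ Lᵧ₃
         L₀₀ L₀₁ L₀₃ L₀ᵧ L₁₀ L₁₁ L₁₂ L₂₁ L₂₂ L₂₃ L₃₀ L₃₂ L₃₃ L₃₄ L₄₃ Lᵧ₀)

    perOn-G′ : perOn L′ V V ≡ + 23 ℤ.* G′.A ℤ.+ + 6 ℤ.* G′.A₄ ℤ.+ + 10 ℤ.* G′.Aᵧ ℤ.+ + 3 ℤ.* G′.A₄ᵧ ℤ.- + 3 ℤ.* G′.Z ℤ.- + 3 ℤ.* G′.Zᵀ
    perOn-G′ = trans (cong (λ W → perOn L′ W W) V≡)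
      (G′.Rewired.perOn-corner (interior-detached {L′} detached′) (pendants-detached {L′} detached′)
         L′₀₂ L′₂₀ L′₁₃ L′₃₁ L′₀₄ L′₄₀ L′₁₄ L′₄₁ L′₂₄ L′₄₂ L′₁ᵧ L′ᵧ₁ L′₂ᵧ L′ᵧ₂ L′₃ᵧ L′ᵧ₃
         L′₀₀ L′₀₁ L′₀₃ L′₀ᵧ L′₁₀ L′₁₁ L′₁₂ L′₂₁ L′₂₂ L′₂₃ L′₃₀ L′₃₂ L′₃₃ L′₃₄ L′₄₃ L′ᵧ₀)

    -- G and G′ differ only at v₁, v₂, v₄, which none of the minors involve
    minors-agree : ∀ rs cs → All (4 ≤_) rs → All (4 ≤_) cs → perOn L′ rs cs ≡ perOn L rs cs
    minors-agree rs cs 4≤rs 4≤cs = perOn-cong-on L′ L rs cs 4≤rs 4≤cs (λ a b 4≤a _ → L′≡L a b 4≤a)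

    4≤interior : All (4 ≤_) interior
    4≤interior = All.map (λ (5≤x , _) → ≤-trans (n≤1+n 4) 5≤x) interior-bounds

    4≤pendants : All (4 ≤_) pendants
    4≤pendants = All.map (λ (K≤x , _) → ≤-trans (≤-trans (n≤1+n 4) (≤-trans (n≤1+n 5) 6≤K)) K≤x) pendants-bounds

    4≤R′ : All (4 ≤_) G.R′
    4≤R′ = ++⁺ 4≤interior (≤-trans (n≤1+n 4) 5≤Y ∷ 4≤pendants)

    4≤R′ᵧ : All (4 ≤_) G.R′ᵧ
    4≤R′ᵧ = ++⁺ 4≤interior 4≤pendants

    Zᵀ≡-1 : G.Zᵀ ≡ -1ℤ
    Zᵀ≡-1 = begin
        perOn L G.R′ G.Rᵧ
          ≡⟨ cong (λ rows → perOn L rows G.Rᵧ) (sym rows≡) ⟩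
        perOn L (iterate suc 5 (suc (Y ∸ 5)) ++ pendants) G.Rᵧ
          ≡⟨ perOn-path (suc (Y ∸ 5)) 4 (s≤s (s≤s (s≤s (s≤s z≤n)))) 5+[Y∸5]≡Y ⟩
        -1ℤ ℤ.* -1ℤ ℤ.^ (Y ∸ 5)
          ≡⟨ cong (λ t → -1ℤ ℤ.* -1ℤ ℤ.^ t) (trans (cong (_∸ 5) Y≡5+[t+t]) (m+n∸m≡n 5 _)) ⟩
        -1ℤ ℤ.* -1ℤ ℤ.^ ((k ∸ 3) + (k ∸ 3))
          ≡⟨ cong (-1ℤ ℤ.*_) (-1^[t+t] (k ∸ 3)) ⟩
        -1ℤ ∎
      where
        open ≡-Reasoning
        -1^[t+t] : ∀ t → -1ℤ ℤ.^ (t + t) ≡ 1ℤ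
        -1^[t+t] zero    = refl
        -1^[t+t] (suc t) rewrite +-suc t t | -1^[t+t] t = refl
        rows≡ : iterate suc 5 (suc (Y ∸ 5)) ++ pendants ≡ G.R′
        rows≡ = trans (cong (λ d → iterate suc 5 d ++ pendants) (sym (+-comm (Y ∸ 5) 1)))
                  (trans (cong (_++ pendants) (iterate-++ 5 (Y ∸ 5) 1))
                    (trans (++-assoc interior (iterate suc (5 + (Y ∸ 5)) 1) pendants)
                           (cong (λ y → interior ++ y ∷ pendants) 5+[Y∸5]≡Y)))

    Z≡-1 : G.Z ≡ -1ℤ
    Z≡-1 = trans (perOn-symmetric L L-sym G.Rᵧ G.R′ (sym (G.length-R′))) Zᵀ≡-1

    A≥1 : 1ℤ ℤ.≤ G.A
    A≥1 = ℤ.≤-trans (∏-≥1 G.R R-diagonal) (∏diagonal≤perOn L colour L-signPattern G.R)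
      where
        R-diagonal : All (λ x → 1ℤ ℤ.≤ L x x) G.R
        R-diagonal = All.map (L-diagonal≥1 _)
          (small<n (s≤s (s≤s (s≤s (s≤s z≤n)))) ∷
           ++⁺ (All.map (λ (_ , x<Y) → <-trans x<Y Y<n) interior-bounds) (Y<n ∷ All.map proj₂ pendants-bounds))

    perOn-L′<perOn-L : perOn L′ V V ℤ.< perOn L V V
    perOn-L′<perOn-L = expansion-comparison perOn-G perOn-G′
      (minors-agree G.R G.R (≤-refl ∷ 4≤R′) (≤-refl ∷ 4≤R′)) (minors-agree G.R′ G.R′ 4≤R′ 4≤R′)
      (minors-agree G.Rᵧ G.Rᵧ (≤-refl ∷ 4≤R′ᵧ) (≤-refl ∷ 4≤R′ᵧ)) (minors-agree G.R′ᵧ G.R′ᵧ 4≤R′ᵧ 4≤R′ᵧ)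
      (minors-agree G.Rᵧ G.R′ (≤-refl ∷ 4≤R′ᵧ) 4≤R′) (minors-agree G.R′ G.Rᵧ 4≤R′ (≤-refl ∷ 4≤R′ᵧ))
      Z≡-1 Zᵀ≡-1 A≥1
      (perOn-principal-nonneg L colour L-signPattern G.R′) (perOn-principal-nonneg L colour L-signPattern G.Rᵧ)
      (perOn-principal-nonneg L colour L-signPattern G.R′ᵧ)

open import Data.Nat using (ℕ; _≤_; _<_; _*_)
open import Data.Integer using () renaming (_<_ to _<ℤ_)
open import Relation.Binary.PropositionalEquality using (sym; subst₂)
open import Defs using (per; laplacian; graphG; graphG')
open LaplacianOnNat using (per-laplacian)
open CycleGraph using (module CycleWithPendants)
open Comparison using (module Estimates)

theorem2p6 : (k i j ni nj : ℕ) → 3 ≤ k → 4 < i → i < j → j ≤ 2 * k →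
  per (laplacian (graphG' k i j ni nj)) <ℤ per (laplacian (graphG k i j ni nj))
theorem2p6 k i j ni nj 3≤k 4<i i<j j≤2k =
  subst₂ _<ℤ_ (sym (per-laplacian n adj′)) (sym (per-laplacian n adj)) perOn-L′<perOn-L
  where
    open CycleWithPendants k i j ni nj 3≤k 4<i i<j j≤2k using (n; adj; adj′)
    open Estimates k i j ni nj 3≤k 4<i i<j j≤2k using (perOn-L′<perOn-L)
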